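{- For all $n$, $D_n([1423];q)=q^n D_n([1324];1/q)$, and for $n\ge2$, $$D_n([1324];q)=\sum_{k=1}^{n-1}\binom{n+k-3}{n-k-1}q^k.$$
   Context: For a linear permutation $\pi=\pi_1\ldots\pi_n$ of $[n]$, the cyclic permutation $[\pi]$ is the set of all rotations of $\pi$. A linear permutation $\sigma$ contains $\pi$ if some subsequence of $\sigma$ is order isomorphic to $\pi$. A cyclic permutation $[\sigma]$ contains $[\pi]$ if some rotation of $\sigma$ contains $\pi$; otherwise it avoids $[\pi]$. $\mathrm{Av}_n[\Pi]$ is the set of cyclic permutations of length $n$ avoiding every pattern in the set $[\Pi]$. The cyclic descent number of $[\pi]$ is $\mathrm{cdes}[\pi]=\#\{i\in[n]: \pi_i>\pi_{i+1}\}$ with subscripts taken modulo $n$ (independent of the representative). $D_n([\Pi];q)=\sum_{[\sigma]\in\mathrm{Av}_n[\Pi]}q^{\mathrm{cdes}[\sigma]}$. -}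

module Defs where

open import Data.Bool using (Bool; true; false; _∧_; _∨_; not; if_then_else_; T)
open import Data.Nat using (ℕ; zero; suc; _+_; _∸_; _<ᵇ_; _≤ᵇ_; _≡ᵇ_)
open import Data.Nat.Combinatorics using (_C_)
open import Data.Fin using (Fin; toℕ)
open import Data.List using (List; []; _∷_; _++_; map; length; upTo)
open import Data.Bool.ListAction using (any; all)
open import Data.Vec using (Vec; toList)
open import Data.Product using (Σ)

-- A linear permutation of [n] is represented by the vector of its values
-- π = π₁ … πₙ, with values in Fin n = {0,…,n-1} (value i stands for i+1).
-- Order isomorphism only depends on relative order, so this shift is harmless.

Word : Set
Word = List ℕ

distinct : Word → Bool
distinct [] = true
distinct (x ∷ xs) = all (λ y → not (x ≡ᵇ y)) xs ∧ distinct xs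

isPerm : {n : ℕ} → Vec (Fin n) n → Bool
isPerm σ = distinct (map toℕ (toList σ))

subseqs : Word → List Word
subseqs [] = [] ∷ []
subseqs (x ∷ xs) = map (x ∷_) (subseqs xs) ++ subseqs xs

_==ᵇ_ : Bool → Bool → Bool
true ==ᵇ b = b
false ==ᵇ b = not b

orderIso : Word → Word → Bool
orderIso a b =
  (length a ≡ᵇ length b) ∧
  all (λ i → all (λ j → (lookupℕ a i <ᵇ lookupℕ a j) ==ᵇ (lookupℕ b i <ᵇ lookupℕ b j))
                 (upTo (length a)))
      (upTo (length a))
  where
  lookupℕ : Word → ℕ → ℕ
  lookupℕ [] _ = 0
  lookupℕ (x ∷ xs) zero = x
  lookupℕ (x ∷ xs) (suc i) = lookupℕ xs i

containsLin : Word → Word → Bool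
containsLin σ π = any (λ s → orderIso s π) (subseqs σ)

rot : Word → Word
rot [] = []
rot (x ∷ xs) = xs ++ (x ∷ [])

rotsN : ℕ → Word → List Word
rotsN zero σ = []
rotsN (suc m) σ = σ ∷ rotsN m (rot σ)

rotations : Word → List Word
rotations σ = rotsN (length σ) σ

-- cyclic containment: some rotation of σ contains π linearly
-- (all rotations of π being patterns in [π], and containment of a rotation
--  of π in a rotation of σ reducing to this, as in the definition)
containsCyc : Word → Word → Bool
containsCyc σ π = any (λ τ → containsLin τ π) (rotations σ)

avoidsAll : Word → List Word → Bool
avoidsAll σ Π = all (λ π → not (containsCyc σ π)) Π

countDes : Word → ℕ
countDes [] = 0
countDes (x ∷ []) = 0
countDes (x ∷ y ∷ ys) = (if y <ᵇ x then 1 else 0) + countDes (y ∷ ys)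

cdes : Word → ℕ
cdes [] = 0
cdes (x ∷ xs) = countDes ((x ∷ xs) ++ (x ∷ []))

-- Cyclic permutations of length n: each class [σ] contains exactly one
-- rotation whose first entry is the smallest value; we use it as the
-- canonical representative of the class.
startsWithMin : Word → Bool
startsWithMin [] = true
startsWithMin (x ∷ xs) = x ≡ᵇ 0

isCycRep : {n : ℕ} → Vec (Fin n) n → Bool
isCycRep σ = isPerm σ ∧ startsWithMin (map toℕ (toList σ))

-- The set of cyclic permutations [σ] of length n avoiding all patterns in [Π]
-- with cdes[σ] = k.  Its cardinality is the coefficient of q^k in D_n([Π];q).
AvDes : (n : ℕ) → List Word → ℕ → Set
AvDes n Π k = Σ (Vec (Fin n) n) λ σ →
  T (isCycRep σ ∧ avoidsAll (map toℕ (toList σ)) Π ∧ (cdes (map toℕ (toList σ)) ≡ᵇ k))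

p1423 : Word
p1423 = 0 ∷ 3 ∷ 1 ∷ 2 ∷ []

p1324 : Word
p1324 = 0 ∷ 2 ∷ 1 ∷ 3 ∷ []

formulaCoef : ℕ → ℕ → ℕ
formulaCoef n k = if (1 ≤ᵇ k) ∧ (k <ᵇ n) then (n + k ∸ 3) C (n ∸ k ∸ 1) else 0

{-# OPTIONS --safe #-}
module Submission where

-- Every class [σ] of length n ≥ 2 has the representative 0 ∷ τ with τ a permutation of {1, …, n − 1}, and
-- cdes (0 ∷ τ) = 1 + des τ. A cyclic occurrence of 1324 is a linear occurrence of one of its rotations
-- 1324, 2413, 3142, 4231; checking them shows that [0 ∷ τ] avoids [1324] iff τ avoids 213 and 4132, and,
-- since reversing turns 1423 into the rotation 3241 of 1324, that [0 ∷ τ] avoids [1423] iff reverse τ avoids them.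
-- In a permutation of [lo, lo + m) avoiding 213 and 4132 the letter lo either comes first, or it is followed by
-- the increasing run lo + 1, …, lo + b and preceded by such a permutation of [lo + 1 + b, lo + m); the second
-- shape adds one descent. Enumerating this recursion, the hockey-stick identity gives C(m − 1 + j, 2j)
-- permutations with j descents, which is the claimed coefficient for m = n − 1 and k = j + 1. Finally
-- des τ + des (reverse τ) = n − 2, so reversal matches k cyclic descents for [1423] with n − k for [1324].

open import Defs

open import Axiom.UniquenessOfIdentityProofs using (module Decidable⇒UIP)
open import Data.Bool using (Bool; true; false; _∧_; not; T; if_then_else_)
open import Data.Bool.ListAction using (all)
open import Data.Bool.Properties using (T-∧; T-≡; T-not-≡; T-irrelevant)
open import Data.Empty using (⊥; ⊥-elim)
open import Data.Fin as F using (Fin; toℕ)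
open import Data.Fin.Properties using (toℕ<n; toℕ-fromℕ<; toℕ-injective)
import Data.List as List
open import Data.List using (List; []; _∷_; _++_; map; reverse; length; drop; take; upTo)
open import Data.List.Properties
  using (reverse-injective; reverse-involutive; unfold-reverse; length-reverse; ≡-dec; ++-cancelʳ; ∷-injectiveˡ;
         ∷-injectiveʳ; length-++-sucʳ; length-map; ++-assoc; ++-identityʳ; take++drop≡id; length-take; length-++;
         length-++-comm)
open import Data.List.Membership.Propositional using (_∈_; _∉_; find; lose)
open import Data.List.Membership.Propositional.Properties
  using (∈-lookup; ∈-∃++; ∈-map⁻; ∈-++⁻; ∈-++⁺ˡ; ∈-++⁺ʳ; ∈-map⁺; ∈-upTo⁺; ∈-upTo⁻)
open import Data.List.Membership.Setoid.Properties using (unique⇒irrelevant)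
open import Data.List.Relation.Binary.Sublist.Propositional
  using (_⊆_; []; _∷_; _∷ʳ_; minimum; ⊆-refl; ⊆-trans; lookup; to∈; from∈)
open import Data.List.Relation.Binary.Sublist.Propositional.Properties
  using (++⁺; ++⁺ˡ; ++⁺ʳ; length-mono-≤; All-resp-⊆; reverse⁺; reverse⁻)
open import Data.List.Relation.Unary.All as All using (All; []; _∷_; all?)
import Data.List.Relation.Unary.All.Properties as All
open import Data.List.Relation.Unary.All.Properties using (all⁺; all⁻)
open import Data.List.Relation.Unary.AllPairs as AllPairs using (AllPairs; []; _∷_)
import Data.List.Relation.Unary.Any as Any
open import Data.List.Relation.Unary.Any using (here; there)
open import Data.List.Relation.Unary.Any.Properties using (any⁺; any⁻) renaming (reverse⁻ to Any-reverse⁻)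
open import Data.List.Relation.Unary.Linked using (Linked; [-]; _∷_)
open import Data.List.Relation.Unary.Linked.Properties using (Linked⇒AllPairs)
open import Data.List.Relation.Unary.Unique.Propositional using (Unique)
import Data.List.Relation.Unary.Unique.Propositional.Properties as Unique
open import Data.Nat using (ℕ; zero; suc; _+_; _∸_; _≟_; _<_; _≤_; _≡ᵇ_; _<ᵇ_; z≤n; s≤s; z<s; s<s)
open import Data.List.Membership.DecPropositional _≟_ using (_∈?_)
open import Data.Nat.Combinatorics using (_C_; k>n⇒nCk≡0; nCk+nC[k+1]≡[n+1]C[k+1]; nCk≡nC[n∸k])
open import Data.Nat.Properties
open import Data.Nat.Solver using (module +-*-Solver)
open +-*-Solver using (solve; _:+_; _:=_; con)
open import Data.Product using (Σ; ∃; ∃₂; _×_; _,_; proj₁; proj₂)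
import Data.Sum as Sum
open import Data.Sum using (_⊎_; inj₁; inj₂)
import Data.Vec as Vec
open import Data.Vec using (Vec)
open import Data.Vec.Properties using (length-toList)
open import Function using (_∘_; id; case_of_)
open import Function.Bundles using (Equivalence; _⇔_; mk⇔; _↔_; mk↔ₛ′)
import Function.Properties.Equivalence as ⇔
open import Function.Properties.Inverse using (↔-sym; ↔-trans)
open import Relation.Binary.Definitions using (tri<; tri≈; tri>)
open import Relation.Binary.PropositionalEquality
  using (_≡_; _≢_; refl; sym; trans; cong; cong₂; subst; subst₂; setoid; module ≡-Reasoning)
open import Relation.Nullary using (¬_; yes; no)
open import Relation.Nullary.Decidable using (from-yes; True; toWitness)

-- Sublists and cyclic containment

T-not⁻ : ∀ {b} → T (not b) → ¬ T b
T-not⁻ {false} _ ()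

T-not⁺ : ∀ {b} → ¬ T b → T (not b)
T-not⁺ {true} ¬b = ¬b _
T-not⁺ {false} _ = _

distinct⇒Unique : ∀ w → T (distinct w) → Unique w
distinct⇒Unique [] _ = []
distinct⇒Unique (x ∷ w) t
  with x≢w , d ← Equivalence.to (T-∧ {all (λ y → not (x ≡ᵇ y)) w}) t
  = All.map (λ t e → T-not⁻ t (≡⇒≡ᵇ x _ e)) (all⁺ _ w x≢w) ∷ distinct⇒Unique w d

Unique⇒distinct : ∀ {w} → Unique w → T (distinct w)
Unique⇒distinct {[]} _ = _
Unique⇒distinct {x ∷ w} (x≢w ∷ u) = Equivalence.from T-∧
  (all⁻ _ (All.map (λ x≢y → T-not⁺ (x≢y ∘ ≡ᵇ⇒≡ x _)) x≢w) , Unique⇒distinct u)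

subseqs⁻ : ∀ {σ s} → s ∈ subseqs σ → s ⊆ σ
subseqs⁻ {[]} (here refl) = []
subseqs⁻ {x ∷ σ} m with ∈-++⁻ (map (x ∷_) (subseqs σ)) m
... | inj₂ m′ = x ∷ʳ subseqs⁻ m′
... | inj₁ m′ with _ , m″ , refl ← ∈-map⁻ (x ∷_) m′ = refl ∷ subseqs⁻ m″

subseqs⁺ : ∀ {s σ} → s ⊆ σ → s ∈ subseqs σ
subseqs⁺ [] = here refl
subseqs⁺ (x ∷ʳ p) = ∈-++⁺ʳ _ (subseqs⁺ p)
subseqs⁺ (refl ∷ p) = ∈-++⁺ˡ (∈-map⁺ _ (subseqs⁺ p))

rotate : ℕ → Word → Word
rotate zero σ = σ
rotate (suc i) σ = rotate i (rot σ)

rotate-++ : ∀ A B → rotate (length A) (A ++ B) ≡ B ++ A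
rotate-++ [] B = sym (++-identityʳ B)
rotate-++ (x ∷ A) B = begin
  rotate (length A) ((A ++ B) ++ x ∷ [])  ≡⟨ cong (rotate (length A)) (++-assoc A B (x ∷ [])) ⟩
  rotate (length A) (A ++ B ++ x ∷ [])    ≡⟨ rotate-++ A (B ++ x ∷ []) ⟩
  (B ++ x ∷ []) ++ A                      ≡⟨ ++-assoc B (x ∷ []) A ⟩
  B ++ x ∷ A                              ∎
  where open ≡-Reasoning

rotate-length : ∀ σ → rotate (length σ) σ ≡ σ
rotate-length σ = trans (cong (rotate (length σ)) (sym (++-identityʳ σ))) (rotate-++ σ [])

rotate≡drop++take : ∀ i σ → i ≤ length σ → rotate i σ ≡ drop i σ ++ take i σ
rotate≡drop++take i σ i≤∣σ∣ = begin
  rotate i σ                                ≡⟨ cong (rotate i) (sym (take++drop≡id i σ)) ⟩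
  rotate i (take i σ ++ drop i σ)           ≡⟨ cong (λ k → rotate k (take i σ ++ drop i σ)) ∣take∣≡i ⟨
  rotate (length (take i σ)) (take i σ ++ drop i σ) ≡⟨ rotate-++ (take i σ) (drop i σ) ⟩
  drop i σ ++ take i σ                      ∎
  where
  open ≡-Reasoning
  ∣take∣≡i : length (take i σ) ≡ i
  ∣take∣≡i = trans (length-take i σ) (m≤n⇒m⊓n≡m i≤∣σ∣)

∈-rotsN⁻ : ∀ m σ {τ} → τ ∈ rotsN m σ → ∃ λ i → i < m × τ ≡ rotate i σ
∈-rotsN⁻ (suc m) σ (here refl) = 0 , z<s , refl
∈-rotsN⁻ (suc m) σ (there τ∈) with i , i<m , refl ← ∈-rotsN⁻ m (rot σ) τ∈ = suc i , s<s i<m , refl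

∈-rotsN⁺ : ∀ m σ {i} → i < m → rotate i σ ∈ rotsN m σ
∈-rotsN⁺ (suc m) σ {zero} _ = here refl
∈-rotsN⁺ (suc m) σ {suc i} (s<s i<m) = there (∈-rotsN⁺ m (rot σ) i<m)

rotate∈rotations : ∀ σ {i} → i ≤ length σ → 0 < length σ → rotate i σ ∈ rotations σ
rotate∈rotations σ i≤∣σ∣ ∣σ∣>0 with m≤n⇒m<n∨m≡n i≤∣σ∣
... | inj₁ i<∣σ∣ = ∈-rotsN⁺ (length σ) σ i<∣σ∣
... | inj₂ refl = subst (_∈ rotations σ) (sym (rotate-length σ)) (∈-rotsN⁺ (length σ) σ ∣σ∣>0)

⊆-++⁻ : ∀ (A : Word) {B s} → s ⊆ A ++ B → ∃₂ λ s₁ s₂ → s ≡ s₁ ++ s₂ × s₁ ⊆ A × s₂ ⊆ B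
⊆-++⁻ [] s⊆B = [] , _ , refl , [] , s⊆B
⊆-++⁻ (x ∷ A) (.x ∷ʳ s⊆) with s₁ , s₂ , refl , s₁⊆ , s₂⊆ ← ⊆-++⁻ A s⊆ = s₁ , s₂ , refl , x ∷ʳ s₁⊆ , s₂⊆
⊆-++⁻ (x ∷ A) (refl ∷ s⊆) with s₁ , s₂ , refl , s₁⊆ , s₂⊆ ← ⊆-++⁻ A s⊆ = x ∷ s₁ , s₂ , refl , refl ∷ s₁⊆ , s₂⊆

++-⊆⁻ : ∀ (s₁ : Word) {s₂ σ} → s₁ ++ s₂ ⊆ σ → ∃₂ λ A B → σ ≡ A ++ B × s₁ ⊆ A × s₂ ⊆ B
++-⊆⁻ [] s₂⊆ = [] , _ , refl , [] , s₂⊆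
++-⊆⁻ (x ∷ s₁) (y ∷ʳ s⊆) with A , B , refl , s₁⊆ , s₂⊆ ← ++-⊆⁻ (x ∷ s₁) s⊆ = y ∷ A , B , refl , y ∷ʳ s₁⊆ , s₂⊆
++-⊆⁻ (x ∷ s₁) (refl ∷ s⊆) with A , B , refl , s₁⊆ , s₂⊆ ← ++-⊆⁻ s₁ s⊆ = x ∷ A , B , refl , refl ∷ s₁⊆ , s₂⊆

orderIso⇒length≡ : ∀ s p → T (orderIso s p) → length s ≡ length p
orderIso⇒length≡ s p o = ≡ᵇ⇒≡ (length s) (length p) (proj₁ (Equivalence.to (T-∧ {length s ≡ᵇ length p}) o))

containsLin⇒ : ∀ σ p → T (containsLin σ p) → ∃ λ s → s ⊆ σ × T (orderIso s p)
containsLin⇒ σ p c with s , s∈ , o ← find (any⁻ _ (subseqs σ) c) = s , subseqs⁻ s∈ , o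

containsLin⇐ : ∀ {σ s} p → s ⊆ σ → T (orderIso s p) → T (containsLin σ p)
containsLin⇐ p s⊆σ o = any⁺ _ (lose (subseqs⁺ s⊆σ) o)

-- A subsequence of a rotation of σ is a rotation s₂ ++ s₁ of a subsequence s₁ ++ s₂ of σ.
CyclicOccurrence : Word → Word → Set
CyclicOccurrence p σ = ∃₂ λ s₁ s₂ → s₁ ++ s₂ ⊆ σ × T (orderIso (s₂ ++ s₁) p)

containsLin-rotate⇒ : ∀ σ p i → i ≤ length σ → T (containsLin (rotate i σ) p) → CyclicOccurrence p σ
containsLin-rotate⇒ σ p i i≤∣σ∣ c with s , s⊆ , o ← containsLin⇒ (rotate i σ) p c
  with s₁ , s₂ , s≡ , s₁⊆ , s₂⊆ ← ⊆-++⁻ (drop i σ) (subst (s ⊆_) (rotate≡drop++take i σ i≤∣σ∣) s⊆)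
  = s₂ , s₁ , subst (s₂ ++ s₁ ⊆_) (take++drop≡id i σ) (++⁺ s₂⊆ s₁⊆) , subst (λ s → T (orderIso s p)) s≡ o

containsCyc⇒ : ∀ σ p → T (containsCyc σ p) → CyclicOccurrence p σ
containsCyc⇒ σ p c with τ , τ∈ , cτ ← find (any⁻ _ (rotations σ) c)
  with i , i<∣σ∣ , τ≡ ← ∈-rotsN⁻ (length σ) σ τ∈
  = containsLin-rotate⇒ σ p i (<⇒≤ i<∣σ∣) (subst (λ τ → T (containsLin τ p)) τ≡ cτ)

containsCyc⇐ : ∀ σ p → 0 < length p → CyclicOccurrence p σ → T (containsCyc σ p)
containsCyc⇐ σ p ∣p∣>0 (s₁ , s₂ , s⊆ , o)
  with A , B , refl , s₁⊆ , s₂⊆ ← ++-⊆⁻ s₁ s⊆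
  = any⁺ _ (lose (rotate∈rotations (A ++ B) ∣A∣≤ ∣σ∣>0)
      (subst (λ τ → T (containsLin τ p)) (sym (rotate-++ A B)) (containsLin⇐ p (++⁺ s₂⊆ s₁⊆) o)))
  where
  ∣A∣≤ : length A ≤ length (A ++ B)
  ∣A∣≤ = subst (length A ≤_) (sym (length-++ A)) (m≤m+n (length A) (length B))
  ∣σ∣>0 : 0 < length (A ++ B)
  ∣σ∣>0 = begin-strict
    0                     <⟨ ∣p∣>0 ⟩
    length p              ≡⟨ orderIso⇒length≡ (s₂ ++ s₁) p o ⟨
    length (s₂ ++ s₁)     ≡⟨ length-++-comm s₂ s₁ ⟩
    length (s₁ ++ s₂)     ≤⟨ length-mono-≤ s⊆ ⟩
    length (A ++ B)       ∎
    where open ≤-Reasoning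

_‼_ : Word → ℕ → ℕ
[] ‼ _ = 0
(x ∷ xs) ‼ zero = x
(x ∷ xs) ‼ suc i = xs ‼ i

-- orderIso with an accessible lookup; on words of known length the two reduce to the same term.
orderIso′ : Word → Word → Bool
orderIso′ s p = (length s ≡ᵇ length p) ∧
  all (λ i → all (λ j → (s ‼ i <ᵇ s ‼ j) ==ᵇ (p ‼ i <ᵇ p ‼ j)) (upTo (length s))) (upTo (length s))

quad : ℕ → ℕ → ℕ → ℕ → Word
quad a b c d = a ∷ b ∷ c ∷ d ∷ []

==ᵇ⇒ : ∀ {b c} → T (b ==ᵇ c) → T c → T b
==ᵇ⇒ {true} _ _ = _
==ᵇ⇒ {false} ¬c c = T-not⁻ ¬c c

==ᵇ⇐ : ∀ {b c} → (T b → T c) → (T c → T b) → T (b ==ᵇ c)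
==ᵇ⇐ {true} b⇒c _ = b⇒c _
==ᵇ⇐ {false} _ c⇒b = T-not⁺ c⇒b

letterOrder : ∀ s p → T (orderIso′ s p) → ∀ i j {i< : True (i <? length s)} {j< : True (j <? length s)}
              {p< : True (p ‼ i <? p ‼ j)} → s ‼ i < s ‼ j
letterOrder s p o i j {i<} {j<} {p<}
  with rows ← proj₂ (Equivalence.to (T-∧ {length s ≡ᵇ length p}) o)
  = <ᵇ⇒< _ _ (==ᵇ⇒ (All.lookup row (∈-upTo⁺ (toWitness j<))) (<⇒<ᵇ (toWitness p<)))
  where row = all⁺ _ _ (All.lookup (all⁺ _ _ rows) (∈-upTo⁺ (toWitness i<)))

‼-map : ∀ (f : ℕ → ℕ) p {i} → i < length p → map f p ‼ i ≡ f (p ‼ i)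
‼-map f (x ∷ p) {zero} _ = refl
‼-map f (x ∷ p) {suc i} (s<s i<) = ‼-map f p i<

‼-∈ : ∀ xs {i} → i < length xs → xs ‼ i ∈ xs
‼-∈ (x ∷ xs) {zero} _ = here refl
‼-∈ (x ∷ xs) {suc i} (s<s i<) = there (‼-∈ xs i<)

Increasing : Word → Set
Increasing = AllPairs _<_

‼-increasing : ∀ {L i j} → Increasing L → i < j → j < length L → L ‼ i < L ‼ j
‼-increasing {x ∷ L} {zero} {suc j} (x<L ∷ _) _ (s<s j<) = All.lookup x<L (‼-∈ L j<)
‼-increasing {x ∷ L} {suc i} {suc j} (_ ∷ inc) (s<s i<j) (s<s j<) = ‼-increasing inc i<j j<

‼-increasing⁻ : ∀ {L i j} → Increasing L → i < length L → j < length L → L ‼ i < L ‼ j → i < j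
‼-increasing⁻ {L} {i} {j} inc i< j< Li<Lj with <-cmp i j
... | tri< i<j _ _ = i<j
... | tri≈ _ refl _ = ⊥-elim (<-irrefl refl Li<Lj)
... | tri> _ _ j<i = ⊥-elim (<-asym Li<Lj (‼-increasing inc j<i i<))

orderIso′-relabel : ∀ L p → Increasing L → All (_< length L) p → T (orderIso′ (map (L ‼_) p) p)
orderIso′-relabel L p inc p<L = Equivalence.from T-∧
  (≡⇒≡ᵇ _ _ (length-map (L ‼_) p) , all⁻ _ (All.tabulate λ i∈ → all⁻ _ (All.tabulate λ j∈ → same-order i∈ j∈)))
  where
  s = map (L ‼_) p
  same-order : ∀ {i j} → i ∈ upTo (length s) → j ∈ upTo (length s) → T ((s ‼ i <ᵇ s ‼ j) ==ᵇ (p ‼ i <ᵇ p ‼ j))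
  same-order {i} {j} i∈ j∈ =
    subst₂ (λ u v → T ((u <ᵇ v) ==ᵇ (p ‼ i <ᵇ p ‼ j))) (sym (‼-map (L ‼_) p i<)) (sym (‼-map (L ‼_) p j<))
      (==ᵇ⇐ (λ t → <⇒<ᵇ (‼-increasing⁻ inc Lpi Lpj (<ᵇ⇒< _ _ t)))
            (λ t → <⇒<ᵇ (‼-increasing inc (<ᵇ⇒< _ _ t) Lpj)))
    where
    i< = subst (i <_) (length-map (L ‼_) p) (∈-upTo⁻ i∈)
    j< = subst (j <_) (length-map (L ‼_) p) (∈-upTo⁻ j∈)
    Lpi = All.lookup p<L (‼-∈ p i<)
    Lpj = All.lookup p<L (‼-∈ p j<)

Rel4 : Set₁
Rel4 = ℕ → ℕ → ℕ → ℕ → Set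

Cyclic : Rel4 → Rel4
Cyclic R a b c d = R a b c d ⊎ R b c d a ⊎ R c d a b ⊎ R d a b c

data Occurs (R : Rel4) (σ : Word) : Set where
  occurs : ∀ {a b c d} → quad a b c d ⊆ σ → R a b c d → Occurs R σ

OrderIso4 : Word → Rel4
OrderIso4 p a b c d = T (orderIso (quad a b c d) p)

data RotatedSplit : Word → Word → Set where
  rot₀ : ∀ {a b c d} → RotatedSplit (quad a b c d) []
  rot₁ : ∀ {a b c d} → RotatedSplit (a ∷ []) (b ∷ c ∷ d ∷ [])
  rot₂ : ∀ {a b c d} → RotatedSplit (a ∷ b ∷ []) (c ∷ d ∷ [])
  rot₃ : ∀ {a b c d} → RotatedSplit (a ∷ b ∷ c ∷ []) (d ∷ [])
  rot₄ : ∀ {a b c d} → RotatedSplit [] (quad a b c d)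

rotatedSplit : ∀ s₁ s₂ → length s₁ + length s₂ ≡ 4 → RotatedSplit s₁ s₂
rotatedSplit (_ ∷ _ ∷ _ ∷ _ ∷ []) [] refl = rot₀
rotatedSplit (_ ∷ []) (_ ∷ _ ∷ _ ∷ []) refl = rot₁
rotatedSplit (_ ∷ _ ∷ []) (_ ∷ _ ∷ []) refl = rot₂
rotatedSplit (_ ∷ _ ∷ _ ∷ []) (_ ∷ []) refl = rot₃
rotatedSplit [] (_ ∷ _ ∷ _ ∷ _ ∷ []) refl = rot₄
rotatedSplit (_ ∷ []) (_ ∷ _ ∷ _ ∷ _ ∷ _) ()
rotatedSplit (_ ∷ _ ∷ []) (_ ∷ _ ∷ _ ∷ _) ()
rotatedSplit (_ ∷ _ ∷ _ ∷ []) (_ ∷ _ ∷ _) ()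
rotatedSplit (_ ∷ _ ∷ _ ∷ _ ∷ []) (_ ∷ _) ()
rotatedSplit (_ ∷ _ ∷ _ ∷ _ ∷ _ ∷ _) _ ()

CyclicOccurrence⇒Occurs : ∀ {σ} p → length p ≡ 4 → CyclicOccurrence p σ → Occurs (Cyclic (OrderIso4 p)) σ
CyclicOccurrence⇒Occurs p ∣p∣≡4 (s₁ , s₂ , s⊆ , o) with rotatedSplit s₁ s₂ ∣s∣≡4
  where
  ∣s∣≡4 : length s₁ + length s₂ ≡ 4
  ∣s∣≡4 = trans (sym (length-++ s₁)) (trans (length-++-comm s₁ s₂) (trans (orderIso⇒length≡ (s₂ ++ s₁) p o) ∣p∣≡4))
... | rot₀ = occurs s⊆ (inj₁ o)
... | rot₁ = occurs s⊆ (inj₂ (inj₁ o))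
... | rot₂ = occurs s⊆ (inj₂ (inj₂ (inj₁ o)))
... | rot₃ = occurs s⊆ (inj₂ (inj₂ (inj₂ o)))
... | rot₄ = occurs s⊆ (inj₁ o)

Occurs⇒CyclicOccurrence : ∀ {σ} p → Occurs (Cyclic (OrderIso4 p)) σ → CyclicOccurrence p σ
Occurs⇒CyclicOccurrence p (occurs s⊆ (inj₁ o)) = _ , [] , s⊆ , o
Occurs⇒CyclicOccurrence p (occurs s⊆ (inj₂ (inj₁ o))) = _ ∷ [] , _ , s⊆ , o
Occurs⇒CyclicOccurrence p (occurs s⊆ (inj₂ (inj₂ (inj₁ o)))) = _ ∷ _ ∷ [] , _ , s⊆ , o
Occurs⇒CyclicOccurrence p (occurs s⊆ (inj₂ (inj₂ (inj₂ o)))) = _ ∷ _ ∷ _ ∷ [] , _ , s⊆ , o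

avoids⇔¬Occurs : ∀ σ p → length p ≡ 4 → T (avoidsAll σ (p ∷ [])) ⇔ (¬ Occurs (Cyclic (OrderIso4 p)) σ)
avoids⇔¬Occurs σ p ∣p∣≡4 = mk⇔
  (λ av occ → T-not⁻ (proj₁ (Equivalence.to T-∧ av)) (containsCyc⇐ σ p ∣p∣>0 (Occurs⇒CyclicOccurrence p occ)))
  (λ ¬occ → Equivalence.from T-∧ (T-not⁺ (¬occ ∘ CyclicOccurrence⇒Occurs p ∣p∣≡4 ∘ containsCyc⇒ σ p) , _))
  where
  ∣p∣>0 : 0 < length p
  ∣p∣>0 = subst (0 <_) (sym ∣p∣≡4) z<s

Occurs-map : ∀ {R S : Rel4} {σ} → (∀ {a b c d} → R a b c d → S a b c d) → Occurs (Cyclic R) σ → Occurs (Cyclic S) σ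
Occurs-map f (occurs s r) = occurs s (Sum.map f (Sum.map f (Sum.map f f)) r)

¬Occurs⇔ : ∀ {R S : Rel4} {σ} → (∀ {a b c d} → R a b c d ⇔ S a b c d) →
           (¬ Occurs (Cyclic R) σ) ⇔ (¬ Occurs (Cyclic S) σ)
¬Occurs⇔ R⇔S = mk⇔ (λ ¬r → ¬r ∘ Occurs-map (Equivalence.from R⇔S)) (λ ¬s → ¬s ∘ Occurs-map (Equivalence.to R⇔S))

Is1324 : Rel4
Is1324 a b c d = Linked _<_ (a ∷ c ∷ b ∷ d ∷ [])

Is1423 : Rel4
Is1423 a b c d = Linked _<_ (a ∷ c ∷ d ∷ b ∷ [])

orderIso⇔Is1324 : ∀ {a b c d} → OrderIso4 p1324 a b c d ⇔ Is1324 a b c d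
orderIso⇔Is1324 {a} {b} {c} {d} = mk⇔
  (λ o → let lt = letterOrder (quad a b c d) p1324 o in lt 0 2 ∷ lt 2 1 ∷ lt 1 3 ∷ [-])
  (λ inc → orderIso′-relabel (a ∷ c ∷ b ∷ d ∷ []) p1324 (Linked⇒AllPairs <-trans inc) (from-yes (all? (_<? 4) p1324)))

orderIso⇔Is1423 : ∀ {a b c d} → OrderIso4 p1423 a b c d ⇔ Is1423 a b c d
orderIso⇔Is1423 {a} {b} {c} {d} = mk⇔
  (λ o → let lt = letterOrder (quad a b c d) p1423 o in lt 0 2 ∷ lt 2 3 ∷ lt 3 1 ∷ [-])
  (λ inc → orderIso′-relabel (a ∷ c ∷ d ∷ b ∷ []) p1423 (Linked⇒AllPairs <-trans inc) (from-yes (all? (_<? 4) p1423)))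

-- Representatives 0 ∷ τ and the linear patterns 213 and 4132

Avoids213 : Word → Set
Avoids213 τ = ∀ x y z → x ∷ y ∷ z ∷ [] ⊆ τ → y < x → x < z → ⊥

Avoids4132 : Word → Set
Avoids4132 τ = ∀ a b c d → quad a b c d ⊆ τ → b < d → d < c → c < a → ⊥

Avoids213∧4132 : Word → Set
Avoids213∧4132 τ = Avoids213 τ × Avoids4132 τ

Avoids213∧4132⇒¬Cyclic1324 : ∀ {τ} → Avoids213∧4132 τ → ¬ Occurs (Cyclic Is1324) τ
Avoids213∧4132⇒¬Cyclic1324 (av213 , _) (occurs s (inj₁ (_ ∷ c<b ∷ b<d ∷ [-]))) =
  av213 _ _ _ (⊆-trans (_ ∷ʳ ⊆-refl) s) c<b b<d
Avoids213∧4132⇒¬Cyclic1324 (_ , av4132) (occurs s (inj₂ (inj₁ (b<d ∷ d<c ∷ c<a ∷ [-])))) =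
  av4132 _ _ _ _ s b<d d<c c<a
Avoids213∧4132⇒¬Cyclic1324 (av213 , _) (occurs s (inj₂ (inj₂ (inj₁ (c<a ∷ a<d ∷ _ ∷ [-]))))) =
  av213 _ _ _ (⊆-trans (refl ∷ _ ∷ʳ ⊆-refl) s) c<a a<d
Avoids213∧4132⇒¬Cyclic1324 (av213 , _) (occurs s (inj₂ (inj₂ (inj₂ (_ ∷ b<a ∷ a<c ∷ [-]))))) =
  av213 _ _ _ (⊆-trans (refl ∷ refl ∷ refl ∷ _ ∷ʳ []) s) b<a a<c

Cyclic1423⇒reverse1324 : ∀ {τ} → Occurs (Cyclic Is1423) τ → Occurs (Cyclic Is1324) (reverse τ)
Cyclic1423⇒reverse1324 (occurs s r) = occurs (reverse⁺ s) (swap r)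
  where
  swap : ∀ {a b c d} → Cyclic Is1423 a b c d → Cyclic Is1324 d c b a
  swap (inj₁ r) = inj₂ (inj₂ (inj₂ r))
  swap (inj₂ (inj₁ r)) = inj₂ (inj₂ (inj₁ r))
  swap (inj₂ (inj₂ (inj₁ r))) = inj₂ (inj₁ r)
  swap (inj₂ (inj₂ (inj₂ r))) = inj₁ r

-- 0 is the smallest letter, so a cyclic occurrence through it has 0 as its 1; what follows 0 is then a 213.
¬Cyclic1324⇔Avoids213∧4132 : ∀ {τ} → All (0 <_) τ → (¬ Occurs (Cyclic Is1324) (0 ∷ τ)) ⇔ Avoids213∧4132 τ
¬Cyclic1324⇔Avoids213∧4132 {τ} τ>0 = mk⇔ (λ ¬occ → av213 ¬occ , av4132 ¬occ) avoid
  where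
  av213 : ¬ Occurs (Cyclic Is1324) (0 ∷ τ) → Avoids213 τ
  av213 ¬occ _ _ _ s y<x x<z =
    ¬occ (occurs (refl ∷ s) (inj₁ (All.lookup τ>0 (lookup s (there (here refl))) ∷ y<x ∷ x<z ∷ [-])))
  av4132 : ¬ Occurs (Cyclic Is1324) (0 ∷ τ) → Avoids4132 τ
  av4132 ¬occ _ _ _ _ s b<d d<c c<a = ¬occ (occurs (0 ∷ʳ s) (inj₂ (inj₁ (b<d ∷ d<c ∷ c<a ∷ [-]))))
  avoid : Avoids213∧4132 τ → ¬ Occurs (Cyclic Is1324) (0 ∷ τ)
  avoid av (occurs (_ ∷ʳ s) r) = Avoids213∧4132⇒¬Cyclic1324 av (occurs s r)
  avoid (av213 , _) (occurs (refl ∷ s) (inj₁ (_ ∷ c<b ∷ b<d ∷ [-]))) = av213 _ _ _ s c<b b<d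
  avoid _ (occurs (refl ∷ s) (inj₂ (inj₁ (_ ∷ _ ∷ () ∷ [-]))))
  avoid _ (occurs (refl ∷ s) (inj₂ (inj₂ (inj₁ (() ∷ _ ∷ _ ∷ [-])))))
  avoid _ (occurs (refl ∷ s) (inj₂ (inj₂ (inj₂ (_ ∷ () ∷ _ ∷ [-])))))

¬Cyclic1423⇔Avoids213∧4132-reverse : ∀ {τ} → All (0 <_) τ →
                                      (¬ Occurs (Cyclic Is1423) (0 ∷ τ)) ⇔ Avoids213∧4132 (reverse τ)
¬Cyclic1423⇔Avoids213∧4132-reverse {τ} τ>0 = mk⇔ (λ ¬occ → av213 ¬occ , av4132 ¬occ) avoid
  where
  av213 : ¬ Occurs (Cyclic Is1423) (0 ∷ τ) → Avoids213 (reverse τ)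
  av213 ¬occ x y z s y<x x<z =
    ¬occ (occurs (refl ∷ s′) (inj₁ (All.lookup τ>0 (lookup s′ (there (here refl))) ∷ y<x ∷ x<z ∷ [-])))
    where
    s′ : z ∷ y ∷ x ∷ [] ⊆ τ
    s′ = reverse⁻ s
  av4132 : ¬ Occurs (Cyclic Is1423) (0 ∷ τ) → Avoids4132 (reverse τ)
  av4132 ¬occ a b c d s b<d d<c c<a = ¬occ (occurs (0 ∷ʳ s′) (inj₂ (inj₂ (inj₁ (b<d ∷ d<c ∷ c<a ∷ [-])))))
    where
    s′ : quad d c b a ⊆ τ
    s′ = reverse⁻ s
  avoid : Avoids213∧4132 (reverse τ) → ¬ Occurs (Cyclic Is1423) (0 ∷ τ)
  avoid av (occurs (_ ∷ʳ s) r) = Avoids213∧4132⇒¬Cyclic1324 av (Cyclic1423⇒reverse1324 (occurs s r))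
  avoid (av213 , _) (occurs (refl ∷ s) (inj₁ (_ ∷ c<d ∷ d<b ∷ [-]))) = av213 _ _ _ (reverse⁺ s) c<d d<b
  avoid _ (occurs (refl ∷ s) (inj₂ (inj₁ (_ ∷ () ∷ _ ∷ [-]))))
  avoid _ (occurs (refl ∷ s) (inj₂ (inj₂ (inj₁ (() ∷ _ ∷ _ ∷ [-])))))
  avoid _ (occurs (refl ∷ s) (inj₂ (inj₂ (inj₂ (_ ∷ _ ∷ () ∷ [-])))))

∈-++-∷⁻ : ∀ {A : Set} {z x : A} xs {ys} → z ∈ xs ++ x ∷ ys → z ≢ x → z ∈ xs ++ ys
∈-++-∷⁻ [] (here z≡x) z≢x = ⊥-elim (z≢x z≡x)
∈-++-∷⁻ [] (there z∈) _ = z∈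
∈-++-∷⁻ (y ∷ xs) (here z≡y) _ = here z≡y
∈-++-∷⁻ (y ∷ xs) (there z∈) z≢x = there (∈-++-∷⁻ xs z∈ z≢x)

Unique⇒length≤ : ∀ {A : Set} {xs ys : List A} → Unique xs → (∀ {z} → z ∈ xs → z ∈ ys) → length xs ≤ length ys
Unique⇒length≤ {xs = []} _ _ = z≤n
Unique⇒length≤ {xs = x ∷ xs} (x≢xs ∷ u) xs⊆ys with ys₁ , ys₂ , refl ← ∈-∃++ (xs⊆ys (here refl)) =
  subst (suc (length xs) ≤_) (sym (length-++-sucʳ ys₁ x ys₂))
    (s≤s (Unique⇒length≤ u λ z∈ → ∈-++-∷⁻ ys₁ (xs⊆ys (there z∈)) λ z≡x → All.lookup x≢xs z∈ (sym z≡x)))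

Unique-⊆ : ∀ {A : Set} {xs ys : List A} → xs ⊆ ys → Unique ys → Unique xs
Unique-⊆ [] u = u
Unique-⊆ (_ ∷ʳ s) (_ ∷ u) = Unique-⊆ s u
Unique-⊆ (refl ∷ s) (x≢ys ∷ u) = All-resp-⊆ s x≢ys ∷ Unique-⊆ s u

interval : ℕ → ℕ → Word
interval u zero = []
interval u (suc w) = u ∷ interval (suc u) w

length-interval : ∀ u w → length (interval u w) ≡ w
length-interval u zero = refl
length-interval u (suc w) = cong suc (length-interval (suc u) w)

∈-interval⁻ : ∀ {x} u w → x ∈ interval u w → u ≤ x × x < u + w
∈-interval⁻ u (suc w) (here refl) = ≤-refl , subst (u <_) (sym (+-suc u w)) (s≤s (m≤m+n u w))
∈-interval⁻ {x} u (suc w) (there x∈) with u<x , x< ← ∈-interval⁻ (suc u) w x∈ =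
  <⇒≤ u<x , subst (x <_) (sym (+-suc u w)) x<

∈-interval⁺ : ∀ {x} u w → u ≤ x → x < u + w → x ∈ interval u w
∈-interval⁺ u zero u≤x x<u+0 = ⊥-elim (<-irrefl refl (<-≤-trans x<u+0 (subst (_≤ _) (sym (+-identityʳ u)) u≤x)))
∈-interval⁺ {x} u (suc w) u≤x x< with u ≟ x
... | yes refl = here refl
... | no u≢x = there (∈-interval⁺ (suc u) w (≤∧≢⇒< u≤x u≢x) (subst (x <_) (+-suc u w) x<))

interval-increasing : ∀ u w → Increasing (interval u w)
interval-increasing u zero = []
interval-increasing u (suc w) = All.tabulate (λ x∈ → proj₁ (∈-interval⁻ (suc u) w x∈)) ∷ interval-increasing (suc u) w

Between : ℕ → ℕ → ℕ → Set
Between u v x = u ≤ x × x < v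

Unique-between⇒length≤ : ∀ {xs} u v → Unique xs → All (Between u v) xs → length xs ≤ v ∸ u
Unique-between⇒length≤ {xs} u v uq bd = begin
  length xs                    ≤⟨ Unique⇒length≤ uq (λ x∈ → let u≤x , x<v = All.lookup bd x∈ in
                                    ∈-interval⁺ u (v ∸ u) u≤x (<-≤-trans x<v (m≤n+m∸n v u))) ⟩
  length (interval u (v ∸ u))  ≡⟨ length-interval u (v ∸ u) ⟩
  v ∸ u                        ∎
  where open ≤-Reasoning

record PermOn (u w : ℕ) (τ : Word) : Set where
  constructor perm
  field
    unique : Unique τ
    bounded : All (Between u (u + w)) τ
    length≡ : length τ ≡ w

PermOn-min∈ : ∀ {u w τ} → PermOn u (suc w) τ → u ∈ τ
PermOn-min∈ {u} {w} {τ} (perm uq bd len) with u ∈? τ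
... | yes u∈ = u∈
... | no u∉ = ⊥-elim (<-irrefl refl (begin-strict
  w                          <⟨ n<1+n w ⟩
  suc w                      ≡⟨ len ⟨
  length τ                   ≤⟨ Unique-between⇒length≤ (suc u) (u + suc w) uq above-u ⟩
  (u + suc w) ∸ suc u        ≡⟨ cong (_∸ suc u) (+-suc u w) ⟩
  (u + w) ∸ u                ≡⟨ m+n∸m≡n u w ⟩
  w                          ∎))
  where
  open ≤-Reasoning
  above-u : All (Between (suc u) (u + suc w)) τ
  above-u = All.tabulate λ x∈ → let u≤x , x< = All.lookup bd x∈ in
    ≤∧≢⇒< u≤x (λ u≡x → u∉ (subst (_∈ τ) (sym u≡x) x∈)) , x<

PermOn-∷ : ∀ {u w β} → PermOn u (suc w) (u ∷ β) → PermOn (suc u) w β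
PermOn-∷ {u} {w} (perm (u≢β ∷ uq) (_ ∷ bd) len) = perm uq bd′ (suc-injective len)
  where
  bd′ : All (Between (suc u) (suc u + w)) _
  bd′ = All.zipWith (λ {x} (u≢x , u≤x , x<) → ≤∧≢⇒< u≤x u≢x , subst (x <_) (+-suc u w) x<) (u≢β , bd)

PermOn-above : ∀ {u w τ} → PermOn (suc u) w τ → All (u <_) τ
PermOn-above p = All.map proj₁ (PermOn.bounded p)

PermOn-++ : ∀ {u w} α β → PermOn u w (α ++ β) → (∀ {x y} → x ∈ α → y ∈ β → y < x) →
            PermOn (u + length β) (length α) α × PermOn u (length β) β
PermOn-++ {u} {w} α β (perm uq bd len) β<α =
  perm (Unique-⊆ (++⁺ʳ β ⊆-refl) uq) (All.tabulate bdα) refl ,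
  perm (Unique-⊆ (++⁺ˡ α ⊆-refl) uq) (All.tabulate bdβ) refl
  where
  open ≤-Reasoning
  w≡ : w ≡ length α + length β
  w≡ = trans (sym len) (length-++ α)
  inτ : ∀ {x} → x ∈ α ⊎ x ∈ β → Between u (u + w) x
  inτ (inj₁ x∈) = All.lookup bd (∈-++⁺ˡ x∈)
  inτ (inj₂ x∈) = All.lookup bd (∈-++⁺ʳ α x∈)
  bdα : ∀ {x} → x ∈ α → Between (u + length β) (u + length β + length α) x
  bdα {x} x∈ with u + length β ≤? x
  ... | yes ≤x = ≤x , subst (x <_) (trans (cong (u +_) (trans w≡ (+-comm (length α) (length β)))) (sym (+-assoc u _ _)))
                                   (proj₂ (inτ (inj₁ x∈)))
  ... | no ≰x = ⊥-elim (<-irrefl refl (begin-strict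
    length β                ≤⟨ Unique-between⇒length≤ u x (Unique-⊆ (++⁺ˡ α ⊆-refl) uq)
                                 (All.tabulate λ y∈ → proj₁ (inτ (inj₂ y∈)) , β<α x∈ y∈) ⟩
    x ∸ u                   <⟨ ∸-monoˡ-< (≰⇒> ≰x) (proj₁ (inτ (inj₁ x∈))) ⟩
    (u + length β) ∸ u      ≡⟨ m+n∸m≡n u (length β) ⟩
    length β                ∎))
  bdβ : ∀ {y} → y ∈ β → Between u (u + length β) y
  bdβ {y} y∈ with u + length β ≤? y
  ... | no ≰y = proj₁ (inτ (inj₂ y∈)) , ≰⇒> ≰y
  ... | yes ≤y = ⊥-elim (<-irrefl refl (begin-strict
    length α                ≤⟨ Unique-between⇒length≤ (suc y) (u + w) (Unique-⊆ (++⁺ʳ β ⊆-refl) uq)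
                                 (All.tabulate λ x∈ → β<α x∈ y∈ , proj₂ (inτ (inj₁ x∈))) ⟩
    (u + w) ∸ suc y         <⟨ ∸-monoʳ-< (s≤s ≤y) (proj₂ (inτ (inj₂ y∈))) ⟩
    (u + w) ∸ (u + length β) ≡⟨ [m+n]∸[m+o]≡n∸o u w (length β) ⟩
    w ∸ length β            ≡⟨ cong (_∸ length β) w≡ ⟩
    (length α + length β) ∸ length β ≡⟨ m+n∸n≡m (length α) (length β) ⟩
    length α                ∎))

Increasing⇒≡interval : ∀ {u w τ} → Increasing τ → PermOn u w τ → τ ≡ interval u w
Increasing⇒≡interval {w = zero} {[]} _ _ = refl
Increasing⇒≡interval {u} {suc w} {x ∷ τ} (x<τ ∷ inc) p with PermOn-min∈ p
... | here refl = cong (u ∷_) (Increasing⇒≡interval inc (PermOn-∷ p))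
... | there u∈τ = ⊥-elim (<-irrefl refl (<-≤-trans (All.lookup x<τ u∈τ) u≤x))
  where u≤x = proj₁ (All.lookup (PermOn.bounded p) (here refl))

<ᵇ-true : ∀ {x y} → x < y → (x <ᵇ y) ≡ true
<ᵇ-true x<y = Equivalence.to T-≡ (<⇒<ᵇ x<y)

<ᵇ-false : ∀ {x y} → y ≤ x → (x <ᵇ y) ≡ false
<ᵇ-false y≤x = Equivalence.to T-not-≡ (T-not⁺ λ t → ≤⇒≯ y≤x (<ᵇ⇒< _ _ t))

countDes-++ : ∀ xs y ys → countDes (xs ++ y ∷ ys) ≡ countDes (xs ++ y ∷ []) + countDes (y ∷ ys)
countDes-++ [] y ys = refl
countDes-++ (x ∷ []) y ys = cong (_+ countDes (y ∷ ys)) (sym (+-identityʳ _))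
countDes-++ (x ∷ x′ ∷ xs) y ys =
  trans (cong (_ +_) (countDes-++ (x′ ∷ xs) y ys)) (sym (+-assoc (if x′ <ᵇ x then 1 else 0) _ _))

countDes-∷ʳ-below : ∀ x xs {y} → All (y <_) (x ∷ xs) → countDes ((x ∷ xs) ++ y ∷ []) ≡ suc (countDes (x ∷ xs))
countDes-∷ʳ-below x [] (y<x ∷ []) = cong (λ b → (if b then 1 else 0) + 0) (<ᵇ-true y<x)
countDes-∷ʳ-below x (x′ ∷ xs) (_ ∷ y<xs) = trans (cong (_ +_) (countDes-∷ʳ-below x′ xs y<xs)) (+-suc _ _)

countDes-below-∷ : ∀ y ys → All (y <_) ys → countDes (y ∷ ys) ≡ countDes ys
countDes-below-∷ y [] _ = refl
countDes-below-∷ y (z ∷ ys) (y<z ∷ _) = cong (λ b → (if b then 1 else 0) + countDes (z ∷ ys)) (<ᵇ-false (<⇒≤ y<z))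

countDes-increasing : ∀ {xs} → Increasing xs → countDes xs ≡ 0
countDes-increasing {[]} _ = refl
countDes-increasing {x ∷ []} _ = refl
countDes-increasing {x ∷ y ∷ xs} ((x<y ∷ _) ∷ inc) =
  trans (cong (λ b → (if b then 1 else 0) + countDes (y ∷ xs)) (<ᵇ-false (<⇒≤ x<y))) (countDes-increasing inc)

countDes-++-run : ∀ x α {lo β} → All (lo <_) (x ∷ α) → All (lo <_) β → Increasing β →
                  countDes ((x ∷ α) ++ lo ∷ β) ≡ suc (countDes (x ∷ α))
countDes-++-run x α {lo} {β} lo<α lo<β inc = begin
  countDes ((x ∷ α) ++ lo ∷ β)                          ≡⟨ countDes-++ (x ∷ α) lo β ⟩
  countDes ((x ∷ α) ++ lo ∷ []) + countDes (lo ∷ β)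
    ≡⟨ cong₂ _+_ (countDes-∷ʳ-below x α lo<α) (countDes-below-∷ lo β lo<β) ⟩
  suc (countDes (x ∷ α)) + countDes β                   ≡⟨ cong (suc (countDes (x ∷ α)) +_) (countDes-increasing inc) ⟩
  suc (countDes (x ∷ α)) + 0                            ≡⟨ +-identityʳ _ ⟩
  suc (countDes (x ∷ α))                                ∎
  where open ≡-Reasoning

countDes-≤ : ∀ y ys → countDes (y ∷ ys) ≤ length ys
countDes-≤ y [] = z≤n
countDes-≤ y (z ∷ ys) with z <ᵇ y
... | true = s≤s (countDes-≤ z ys)
... | false = m≤n⇒m≤1+n (countDes-≤ z ys)

cdes≤length : ∀ w → cdes w ≤ length w
cdes≤length [] = z≤n
cdes≤length (x ∷ w) =
  subst (countDes (x ∷ w ++ x ∷ []) ≤_) (trans (length-++ w) (+-comm (length w) 1)) (countDes-≤ x (w ++ x ∷ []))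

[x<y]+[y<x]≡1 : ∀ {x y} → x ≢ y → (if x <ᵇ y then 1 else 0) + (if y <ᵇ x then 1 else 0) ≡ 1
[x<y]+[y<x]≡1 {x} {y} x≢y with <-cmp x y
... | tri< x<y _ _ rewrite <ᵇ-true x<y | <ᵇ-false (<⇒≤ x<y) = refl
... | tri≈ _ x≡y _ = ⊥-elim (x≢y x≡y)
... | tri> _ _ y<x rewrite <ᵇ-true y<x | <ᵇ-false (<⇒≤ y<x) = refl

-- Every adjacent pair of distinct letters is a descent either in τ or in its reversal.
countDes-reverse : ∀ x τ → Unique (x ∷ τ) → countDes (reverse (x ∷ τ)) + countDes (x ∷ τ) ≡ length τ
countDes-reverse x [] _ = refl
countDes-reverse x (y ∷ τ) ((x≢y ∷ _) ∷ uq) = begin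
  countDes (reverse (x ∷ y ∷ τ)) + (q + B)      ≡⟨ cong (λ w → countDes w + (q + B)) reverse≡ ⟩
  countDes (reverse τ ++ y ∷ x ∷ []) + (q + B)  ≡⟨ cong (_+ (q + B)) (countDes-++ (reverse τ) y (x ∷ [])) ⟩
  (countDes (reverse τ ++ y ∷ []) + (p + 0)) + (q + B)
    ≡⟨ cong (λ w → (countDes w + (p + 0)) + (q + B)) (unfold-reverse y τ) ⟨
  (A + (p + 0)) + (q + B)
    ≡⟨ solve 4 (λ A p q B → (A :+ (p :+ con 0)) :+ (q :+ B) := (A :+ B) :+ (p :+ q)) refl A p q B ⟩
  (A + B) + (p + q)                             ≡⟨ cong₂ _+_ (countDes-reverse y τ uq) ([x<y]+[y<x]≡1 x≢y) ⟩
  length τ + 1                                  ≡⟨ +-comm (length τ) 1 ⟩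
  suc (length τ)                                ∎
  where
  open ≡-Reasoning
  A = countDes (reverse (y ∷ τ))
  B = countDes (y ∷ τ)
  p = if x <ᵇ y then 1 else 0
  q = if y <ᵇ x then 1 else 0
  reverse≡ : reverse (x ∷ y ∷ τ) ≡ reverse τ ++ y ∷ x ∷ []
  reverse≡ = trans (unfold-reverse x (y ∷ τ))
    (trans (cong (_++ x ∷ []) (unfold-reverse y τ)) (++-assoc (reverse τ) (y ∷ []) (x ∷ [])))

Unique-reverse : ∀ {τ : Word} → Unique τ → Unique (reverse τ)
Unique-reverse {[]} _ = []
Unique-reverse {x ∷ τ} (x≢τ ∷ uq) = subst Unique (sym (unfold-reverse x τ))
  (Unique.++⁺ (Unique-reverse uq) ([] ∷ []) λ { (x∈ , here refl) → All.lookup x≢τ (Any-reverse⁻ x∈) refl })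

PermOn-reverse : ∀ {u w τ} → PermOn u w τ → PermOn u w (reverse τ)
PermOn-reverse {τ = τ} (perm uq bd len) =
  perm (Unique-reverse uq) (All.tabulate (All.lookup bd ∘ Any-reverse⁻)) (trans (length-reverse τ) len)

-- Structure of the permutations avoiding 213 and 4132

Avoids213∧4132-⊆ : ∀ {s t} → s ⊆ t → Avoids213∧4132 t → Avoids213∧4132 s
Avoids213∧4132-⊆ s⊆t (av213 , av4132) =
  (λ x y z p → av213 x y z (⊆-trans p s⊆t)) , (λ a b c d p → av4132 a b c d (⊆-trans p s⊆t))

Increasing-pair : ∀ {x y τ} → Increasing τ → x ∷ y ∷ [] ⊆ τ → x < y
Increasing-pair (_ ∷ inc) (_ ∷ʳ p) = Increasing-pair inc p
Increasing-pair (x<τ ∷ _) (refl ∷ p) = All.lookup x<τ (to∈ p)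

Increasing-pairs : ∀ {τ} → (∀ {x y} → x ∷ y ∷ [] ⊆ τ → x < y) → Increasing τ
Increasing-pairs {[]} _ = []
Increasing-pairs {x ∷ τ} pairs = All.tabulate (λ y∈ → pairs (refl ∷ from∈ y∈)) ∷ Increasing-pairs (pairs ∘ (x ∷ʳ_))

Unique-pair : ∀ {x y : ℕ} {τ} → Unique τ → x ∷ y ∷ [] ⊆ τ → x ≢ y
Unique-pair u p with (x≢y ∷ []) ∷ _ ← Unique-⊆ p u = x≢y

Avoids213∧4132-∷ : ∀ {lo β} → All (lo <_) β → Avoids213∧4132 β → Avoids213∧4132 (lo ∷ β)
Avoids213∧4132-∷ {lo} {β} lo<β (av213 , av4132) = av213′ , av4132′
  where
  av213′ : Avoids213 (lo ∷ β)
  av213′ x y z (_ ∷ʳ p) = av213 x y z p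
  av213′ x y z (refl ∷ p) y<lo _ = <-asym y<lo (All.lookup lo<β (to∈ p))
  av4132′ : Avoids4132 (lo ∷ β)
  av4132′ a b c d (_ ∷ʳ p) = av4132 a b c d p
  av4132′ a b c d (refl ∷ p) b<d d<c c<lo = <-asym (<-trans b<d (<-trans d<c c<lo)) (All.lookup lo<β (to∈ p))

Avoids213∧4132-++ : ∀ {α γ} → Avoids213∧4132 α → Increasing γ → (∀ {x y} → x ∈ α → y ∈ γ → y < x) →
                    Avoids213∧4132 (α ++ γ)
Avoids213∧4132-++ {α} {γ} (av213 , av4132) inc γ<α = av213′ , av4132′
  where
  below : ∀ {x y s₁ s₂} → x ∷ s₁ ⊆ α → y ∷ s₂ ⊆ γ → y < x
  below p q = γ<α (to∈ p) (to∈ q)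
  split213 : ∀ {x y z} → y < x → x < z → ∀ s₁ s₂ → x ∷ y ∷ z ∷ [] ≡ s₁ ++ s₂ → s₁ ⊆ α → s₂ ⊆ γ → ⊥
  split213 y<x _ [] _ refl _ q = <-asym y<x (Increasing-pair inc (⊆-trans (refl ∷ refl ∷ _ ∷ʳ []) q))
  split213 _ x<z (_ ∷ []) _ refl p q = <-asym x<z (below p (⊆-trans (_ ∷ʳ ⊆-refl) q))
  split213 _ x<z (_ ∷ _ ∷ []) _ refl p q = <-asym x<z (below p q)
  split213 y<x x<z (_ ∷ _ ∷ _ ∷ []) [] refl p _ = av213 _ _ _ p y<x x<z
  av213′ : Avoids213 (α ++ γ)
  av213′ x y z p y<x x<z with s₁ , s₂ , e , p₁ , p₂ ← ⊆-++⁻ α p = split213 y<x x<z s₁ s₂ e p₁ p₂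
  split4132 : ∀ {a b c d} → b < d → d < c → c < a → ∀ s₁ s₂ → quad a b c d ≡ s₁ ++ s₂ → s₁ ⊆ α → s₂ ⊆ γ → ⊥
  split4132 _ d<c _ [] _ refl _ q = <-asym d<c (Increasing-pair inc (⊆-trans (_ ∷ʳ _ ∷ʳ ⊆-refl) q))
  split4132 _ d<c _ (_ ∷ []) _ refl _ q = <-asym d<c (Increasing-pair inc (⊆-trans (_ ∷ʳ ⊆-refl) q))
  split4132 b<d _ _ (_ ∷ _ ∷ []) _ refl p q = <-asym b<d (below (⊆-trans (_ ∷ʳ ⊆-refl) p) (⊆-trans (_ ∷ʳ ⊆-refl) q))
  split4132 b<d _ _ (_ ∷ _ ∷ _ ∷ []) _ refl p q = <-asym b<d (below (⊆-trans (_ ∷ʳ ⊆-refl) p) q)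
  split4132 b<d d<c c<a (_ ∷ _ ∷ _ ∷ _ ∷ []) [] refl p _ = av4132 _ _ _ _ p b<d d<c c<a
  av4132′ : Avoids4132 (α ++ γ)
  av4132′ a b c d p b<d d<c c<a with s₁ , s₂ , e , p₁ , p₂ ← ⊆-++⁻ α p = split4132 b<d d<c c<a s₁ s₂ e p₁ p₂

data Decomposition (lo m : ℕ) : Word → Set where
  min-first : ∀ {β} → PermOn (suc lo) m β → Avoids213∧4132 β → Decomposition lo m (lo ∷ β)
  min-before-run : ∀ {α} a b → suc a + b ≡ m → PermOn (suc lo + b) (suc a) α → Avoids213∧4132 α →
                   Decomposition lo m (α ++ lo ∷ interval (suc lo) b)

-- A letter after lo exceeding a letter x before it would form 213 with x and lo, and a descent after lo
-- would form 4132 with the first letter; so lo is followed by an increasing run below everything before lo.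
decompose : ∀ {lo m τ} → PermOn lo (suc m) τ → Avoids213∧4132 τ → Decomposition lo m τ
decompose {lo} p good with α , β , refl ← ∈-∃++ (PermOn-min∈ p) = decompose-at α β p good
  where
  decompose-at : ∀ {m} α β → PermOn lo (suc m) (α ++ lo ∷ β) → Avoids213∧4132 (α ++ lo ∷ β) →
                 Decomposition lo m (α ++ lo ∷ β)
  decompose-at [] β p good = min-first (PermOn-∷ p) (Avoids213∧4132-⊆ (lo ∷ʳ ⊆-refl) good)
  decompose-at {m} (x ∷ α) β p@(perm uq bd len) good@(av213 , av4132) =
    subst (λ β → Decomposition lo m ((x ∷ α) ++ lo ∷ β)) (sym β≡interval)
      (min-before-run (length α) (length β) size≡
        (subst (λ u → PermOn u (suc (length α)) (x ∷ α)) (+-suc lo (length β)) pα)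
        (Avoids213∧4132-⊆ (++⁺ʳ (lo ∷ β) ⊆-refl) good))
    where
    τ = (x ∷ α) ++ lo ∷ β
    above : ∀ {z} → z ∈ τ → z ≢ lo → lo < z
    above z∈ z≢lo = ≤∧≢⇒< (proj₁ (All.lookup bd z∈)) (z≢lo ∘ sym)
    lo<α : All (lo <_) (x ∷ α)
    lo<α = All.tabulate λ z∈ → above (∈-++⁺ˡ z∈) (Unique-pair uq (++⁺ (from∈ z∈) (refl ∷ minimum β)))
    lo<β : All (lo <_) β
    lo<β = All.tabulate λ y∈ → above (∈-++⁺ʳ (x ∷ α) (there y∈)) (Unique-pair uq (++⁺ˡ (x ∷ α) (refl ∷ from∈ y∈)) ∘ sym)
    β<α : ∀ {z y} → z ∈ x ∷ α → y ∈ β → y < z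
    β<α {z} {y} z∈ y∈ with <-cmp z y
    ... | tri< z<y _ _ = ⊥-elim (av213 z lo y (++⁺ (from∈ z∈) (refl ∷ from∈ y∈)) (All.lookup lo<α z∈) z<y)
    ... | tri≈ _ z≡y _ = ⊥-elim (Unique-pair uq (++⁺ (from∈ z∈) (lo ∷ʳ from∈ y∈)) z≡y)
    ... | tri> _ _ y<z = y<z
    increasing : Increasing (lo ∷ β)
    increasing = lo<β ∷ Increasing-pairs λ {y₁} {y₂} q → case <-cmp y₁ y₂ of λ where
      (tri< y₁<y₂ _ _) → y₁<y₂
      (tri≈ _ y₁≡y₂ _) → ⊥-elim (Unique-pair uq (++⁺ˡ (x ∷ α) (lo ∷ʳ q)) y₁≡y₂)
      (tri> _ _ y₂<y₁) → ⊥-elim (av4132 x lo y₁ y₂ (refl ∷ ++⁺ˡ α (refl ∷ q))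
                                   (All.lookup lo<β (to∈ (⊆-trans (_ ∷ʳ ⊆-refl) q))) y₂<y₁ (β<α (here refl) (to∈ q)))
    lo∷β<α : ∀ {z y} → z ∈ x ∷ α → y ∈ lo ∷ β → y < z
    lo∷β<α z∈ (here refl) = All.lookup lo<α z∈
    lo∷β<α z∈ (there y∈) = β<α z∈ y∈
    pα = proj₁ (PermOn-++ (x ∷ α) (lo ∷ β) p lo∷β<α)
    β≡interval : β ≡ interval (suc lo) (length β)
    β≡interval = ∷-injectiveʳ (Increasing⇒≡interval increasing (proj₂ (PermOn-++ (x ∷ α) (lo ∷ β) p lo∷β<α)))
    size≡ : suc (length α) + length β ≡ m
    size≡ = suc-injective (begin
      suc (suc (length α) + length β)  ≡⟨ cong suc (+-suc (length α) (length β)) ⟨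
      suc (length α + suc (length β))  ≡⟨ cong suc (length-++ α) ⟨
      length τ                         ≡⟨ len ⟩
      suc m                            ∎)
      where open ≡-Reasoning

-- Generating and counting the permutations avoiding 213 and 4132

PermOn-∷⁺ : ∀ {u w β} → PermOn (suc u) w β → PermOn u (suc w) (u ∷ β)
PermOn-∷⁺ {u} {w} (perm uq bd len) =
  perm (All.map (λ u<x u≡x → <-irrefl u≡x u<x) (All.map proj₁ bd) ∷ uq)
       ((≤-refl , u<u+1+w) ∷ All.map (λ {x} (u<x , x<) → <⇒≤ u<x , subst (x <_) (sym (+-suc u w)) x<) bd)
       (cong suc len)
  where
  u<u+1+w : u < u + suc w
  u<u+1+w = subst (u <_) (sym (+-suc u w)) (s≤s (m≤m+n u w))

PermOn-++⁺ : ∀ {u w₁ w₂ α γ} → PermOn (u + w₁) w₂ α → PermOn u w₁ γ → PermOn u (w₁ + w₂) (α ++ γ)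
PermOn-++⁺ {u} {w₁} {w₂} {α} {γ} (perm uqα bdα lenα) (perm uqγ bdγ lenγ) =
  perm (Unique.++⁺ uqα uqγ λ (x∈α , x∈γ) →
          <-irrefl refl (<-≤-trans (proj₂ (All.lookup bdγ x∈γ)) (proj₁ (All.lookup bdα x∈α))))
       (All.++⁺ (All.map (λ {x} (≤x , x<) → ≤-trans (m≤m+n u w₁) ≤x , subst (x <_) (+-assoc u w₁ w₂) x<) bdα)
                (All.map (λ {y} (≤y , y<) → ≤y , <-≤-trans y< (+-monoʳ-≤ u (m≤m+n w₁ w₂))) bdγ))
       (trans (length-++ α) (trans (cong₂ _+_ lenα lenγ) (+-comm w₂ w₁)))

interval-PermOn : ∀ u w → PermOn u w (interval u w)
interval-PermOn u w = perm (AllPairs.map <⇒≢ (interval-increasing u w))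
  (All.tabulate λ x∈ → ∈-interval⁻ u w x∈) (length-interval u w)

++-∷-cancel : ∀ {x : ℕ} α₁ α₂ {r₁ r₂} → x ∉ α₁ → x ∉ α₂ → α₁ ++ x ∷ r₁ ≡ α₂ ++ x ∷ r₂ → α₁ ≡ α₂
++-∷-cancel [] [] _ _ _ = refl
++-∷-cancel [] (y ∷ α₂) _ x∉α₂ refl = ⊥-elim (x∉α₂ (here refl))
++-∷-cancel (y ∷ α₁) [] x∉α₁ _ refl = ⊥-elim (x∉α₁ (here refl))
++-∷-cancel (y ∷ α₁) (z ∷ α₂) x∉α₁ x∉α₂ e = cong₂ _∷_ (∷-injectiveˡ e)
  (++-∷-cancel α₁ α₂ (x∉α₁ ∘ there) (x∉α₂ ∘ there) (∷-injectiveʳ e))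

Avoider : ℕ → ℕ → ℕ → Word → Set
Avoider lo m j τ = PermOn lo m τ × Avoids213∧4132 τ × countDes τ ≡ j

Avoider-∷ : ∀ {lo m j β} → Avoider (suc lo) m j β → Avoider lo (suc m) j (lo ∷ β)
Avoider-∷ {lo} {β = β} (p , good , des) =
  PermOn-∷⁺ p , Avoids213∧4132-∷ (PermOn-above p) good , trans (countDes-below-∷ lo β (PermOn-above p)) des

Avoider-++-run : ∀ {lo a b j α} → Avoider (suc lo + b) (suc a) j α →
                 Avoider lo (suc b + suc a) (suc j) (α ++ lo ∷ interval (suc lo) b)
Avoider-++-run {lo} {a} {b} {α = x ∷ α} (p , good , des) =
  PermOn-++⁺ (subst (λ u → PermOn u (suc a) (x ∷ α)) (sym (+-suc lo b)) p) (interval-PermOn lo (suc b)) ,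
  Avoids213∧4132-++ good (interval-increasing lo (suc b))
    (λ {_} {y} x∈ y∈ →
       <-≤-trans (subst (y <_) (+-suc lo b) (proj₂ (∈-interval⁻ lo (suc b) y∈))) (proj₁ (All.lookup bd x∈))) ,
  trans (countDes-++-run x α (All.map (λ (≤x , _) → <-≤-trans (s≤s (m≤m+n lo b)) ≤x) bd)
           (All.tabulate λ y∈ → proj₁ (∈-interval⁻ (suc lo) b y∈)) (interval-increasing (suc lo) b))
        (cong suc des)
  where
  bd = PermOn.bounded p

withRuns : (ℕ → ℕ → List Word) → ℕ → ℕ → ℕ → List Word
withRuns G lo m zero = []
withRuns G lo m (suc a) =
  withRuns G lo m a ++ map (_++ lo ∷ interval (suc lo) (m ∸ suc a)) (G (suc lo + (m ∸ suc a)) (suc a))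

∈-withRuns⁻ : ∀ G lo m c {τ} → τ ∈ withRuns G lo m c →
  ∃ λ a → a < c × ∃ λ α → α ∈ G (suc lo + (m ∸ suc a)) (suc a) × τ ≡ α ++ lo ∷ interval (suc lo) (m ∸ suc a)
∈-withRuns⁻ G lo m (suc c) τ∈ with ∈-++⁻ (withRuns G lo m c) τ∈
... | inj₁ τ∈′ with a , a<c , rest ← ∈-withRuns⁻ G lo m c τ∈′ = a , m<n⇒m<1+n a<c , rest
... | inj₂ τ∈′ with α , α∈ , τ≡ ← ∈-map⁻ _ τ∈′ = c , n<1+n c , α , α∈ , τ≡

∈-withRuns⁺ : ∀ G lo m {c a α} → a < c → α ∈ G (suc lo + (m ∸ suc a)) (suc a) →
              α ++ lo ∷ interval (suc lo) (m ∸ suc a) ∈ withRuns G lo m c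
∈-withRuns⁺ G lo m {suc c} {a} a<1+c α∈ with m<1+n⇒m<n∨m≡n a<1+c
... | inj₁ a<c = ∈-++⁺ˡ (∈-withRuns⁺ G lo m a<c α∈)
... | inj₂ refl = ∈-++⁺ʳ (withRuns G lo m a) (∈-map⁺ _ α∈)

withRuns-unique : ∀ G lo m c → (∀ {a} → Unique (G (suc lo + (m ∸ suc a)) (suc a))) →
                  (∀ {a α} → α ∈ G (suc lo + (m ∸ suc a)) (suc a) → length α ≡ suc a × lo ∉ α) →
                  Unique (withRuns G lo m c)
withRuns-unique G lo m zero _ _ = []
withRuns-unique G lo m (suc c) uq shape =
  Unique.++⁺ (withRuns-unique G lo m c uq shape) (Unique.map⁺ (λ {α₁} {α₂} → ++-cancelʳ _ α₁ α₂) uq) disjoint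
  where
  disjoint : ∀ {τ} → ¬ (τ ∈ withRuns G lo m c × τ ∈ map (_++ lo ∷ interval (suc lo) (m ∸ suc c)) (G _ (suc c)))
  disjoint (τ∈₁ , τ∈₂)
    with a , a<c , α₁ , α₁∈ , refl ← ∈-withRuns⁻ G lo m c τ∈₁
    with α₂ , α₂∈ , τ≡ ← ∈-map⁻ _ τ∈₂
    with len₁ , lo∉α₁ ← shape α₁∈
    with len₂ , lo∉α₂ ← shape α₂∈
    = <-irrefl (suc-injective (trans (sym len₁) (trans (cong length (++-∷-cancel α₁ α₂ lo∉α₁ lo∉α₂ τ≡)) len₂))) a<c

sumBelow : (ℕ → ℕ) → ℕ → ℕ
sumBelow g zero = 0
sumBelow g (suc c) = sumBelow g c + g c

length-withRuns : ∀ G lo m c (N : ℕ → ℕ) → (∀ {a} → a < c → length (G (suc lo + (m ∸ suc a)) (suc a)) ≡ N a) →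
                  length (withRuns G lo m c) ≡ sumBelow N c
length-withRuns G lo m zero N _ = refl
length-withRuns G lo m (suc c) N len = begin
  length (withRuns G lo m (suc c))                           ≡⟨ length-++ (withRuns G lo m c) ⟩
  length (withRuns G lo m c) + length (map _ (G _ (suc c)))  ≡⟨ cong₂ _+_ (length-withRuns G lo m c N (len ∘ m<n⇒m<1+n))
                                                                  (trans (length-map _ (G _ (suc c))) (len (n<1+n c))) ⟩
  sumBelow N c + N c                                         ∎
  where open ≡-Reasoning

-- f is fuel: the list is complete once f ≥ m.
avoiderList : (f lo m j : ℕ) → List Word
avoiderList _ lo zero zero = [] ∷ []
avoiderList _ lo zero (suc j) = []
avoiderList zero lo (suc m) j = []
avoiderList (suc f) lo (suc m) zero = map (lo ∷_) (avoiderList f (suc lo) m zero)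
avoiderList (suc f) lo (suc m) (suc j) =
  map (lo ∷_) (avoiderList f (suc lo) m (suc j)) ++ withRuns (λ u a → avoiderList f u a j) lo m m

avoiderList-sound : ∀ f lo m j {τ} → τ ∈ avoiderList f lo m j → Avoider lo m j τ
avoiderList-sound _ lo zero zero (here refl) = perm [] [] refl , ((λ _ _ _ ()) , (λ _ _ _ _ ())) , refl
avoiderList-sound (suc f) lo (suc m) zero τ∈ with β , β∈ , refl ← ∈-map⁻ _ τ∈ =
  Avoider-∷ (avoiderList-sound f (suc lo) m zero β∈)
avoiderList-sound (suc f) lo (suc m) (suc j) τ∈ with ∈-++⁻ (map (lo ∷_) (avoiderList f (suc lo) m (suc j))) τ∈
... | inj₁ τ∈′ with β , β∈ , refl ← ∈-map⁻ _ τ∈′ = Avoider-∷ (avoiderList-sound f (suc lo) m (suc j) β∈)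
... | inj₂ τ∈′ with a , a<m , α , α∈ , refl ← ∈-withRuns⁻ _ lo m m τ∈′ =
  subst (λ w → Avoider lo w (suc j) (α ++ lo ∷ interval (suc lo) (m ∸ suc a))) (cong suc (m∸n+n≡m a<m))
    (Avoider-++-run (avoiderList-sound f _ (suc a) j α∈))

avoiderList-complete : ∀ f lo m j {τ} → m ≤ f → Avoider lo m j τ → τ ∈ avoiderList f lo m j
avoiderList-complete f lo zero zero {[]} _ _ = here refl
avoiderList-complete f lo zero j {_ ∷ _} _ (perm _ _ () , _)
avoiderList-complete (suc f) lo (suc m) j (s≤s m≤f) (p , good , des) with decompose p good
... | min-first pβ goodβ = lo-first j (pβ , goodβ , trans (sym (countDes-below-∷ lo _ (PermOn-above pβ))) des)
  where
  lo-first : ∀ j {β} → Avoider (suc lo) m j β → lo ∷ β ∈ avoiderList (suc f) lo (suc m) j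
  lo-first zero gβ = ∈-map⁺ _ (avoiderList-complete f (suc lo) m zero m≤f gβ)
  lo-first (suc j) gβ = ∈-++⁺ˡ (∈-map⁺ _ (avoiderList-complete f (suc lo) m (suc j) m≤f gβ))
... | min-before-run {α} a b size≡ pα goodα
  with refl ← trans (sym des) (proj₂ (proj₂ (Avoider-++-run {j = countDes α} (pα , goodα , refl)))) =
  ∈-++⁺ʳ _ (subst (λ b → α ++ lo ∷ interval (suc lo) b ∈ withRuns _ lo m m) b≡ (∈-withRuns⁺ _ lo m a<m α∈))
  where
  b≡ : m ∸ suc a ≡ b
  b≡ = trans (cong (_∸ suc a) (sym size≡)) (m+n∸m≡n (suc a) b)
  a<m : a < m
  a<m = subst (a <_) size≡ (m≤m+n (suc a) b)
  α∈ : α ∈ avoiderList f (suc lo + (m ∸ suc a)) (suc a) (countDes α)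
  α∈ = avoiderList-complete f _ (suc a) (countDes α) (≤-trans a<m m≤f)
         (subst (λ b → PermOn (suc lo + b) (suc a) α) (sym b≡) pα , goodα , refl)

avoiderList-unique : ∀ f lo m j → Unique (avoiderList f lo m j)
avoiderList-unique _ lo zero zero = [] ∷ []
avoiderList-unique _ lo zero (suc j) = []
avoiderList-unique zero lo (suc m) j = []
avoiderList-unique (suc f) lo (suc m) zero = Unique.map⁺ ∷-injectiveʳ (avoiderList-unique f (suc lo) m zero)
avoiderList-unique (suc f) lo (suc m) (suc j) =
  Unique.++⁺ (Unique.map⁺ ∷-injectiveʳ (avoiderList-unique f (suc lo) m (suc j)))
             (withRuns-unique _ lo m m (λ {a} → avoiderList-unique f (suc lo + (m ∸ suc a)) (suc a) j) shape) disjoint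
  where
  shape : ∀ {a α} → α ∈ avoiderList f (suc lo + (m ∸ suc a)) (suc a) j → length α ≡ suc a × lo ∉ α
  shape α∈ with perm _ bd len , _ ← avoiderList-sound f _ _ j α∈ =
    len , λ lo∈ → <-irrefl refl (<-≤-trans (s≤s (m≤m+n lo _)) (proj₁ (All.lookup bd lo∈)))
  disjoint : ∀ {τ} → ¬ (τ ∈ map (lo ∷_) (avoiderList f (suc lo) m (suc j)) × τ ∈ withRuns _ lo m m)
  disjoint (τ∈₁ , τ∈₂)
    with β , _ , refl ← ∈-map⁻ _ τ∈₁
    with a , _ , α , α∈ , τ≡ ← ∈-withRuns⁻ _ lo m m τ∈₂
    with len , lo∉α ← shape α∈
    with x ∷ α′ ← α
    = lo∉α (here (∷-injectiveˡ τ≡))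

avoiderCount : ℕ → ℕ → ℕ
avoiderCount zero zero = 1
avoiderCount zero (suc j) = 0
avoiderCount (suc m) j = (m + j) C (j + j)

hockey-stick : ∀ j c → sumBelow (λ a → avoiderCount (suc a) j) c ≡ (c + j) C suc (j + j)
hockey-stick j zero = sym (k>n⇒nCk≡0 (s≤s (m≤m+n j j)))
hockey-stick j (suc c) = begin
  sumBelow (λ a → avoiderCount (suc a) j) c + (c + j) C (j + j)  ≡⟨ cong (_+ (c + j) C (j + j)) (hockey-stick j c) ⟩
  (c + j) C suc (j + j) + (c + j) C (j + j)                   ≡⟨ +-comm ((c + j) C suc (j + j)) _ ⟩
  (c + j) C (j + j) + (c + j) C suc (j + j)                   ≡⟨ nCk+nC[k+1]≡[n+1]C[k+1] (c + j) (j + j) ⟩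
  suc (c + j) C suc (j + j)                                   ∎
  where open ≡-Reasoning

avoiderCount-suc : ∀ m j →
                   avoiderCount (suc m) (suc j) ≡ avoiderCount m (suc j) + sumBelow (λ a → avoiderCount (suc a) j) m
avoiderCount-suc zero j = k>n⇒nCk≡0 (s≤s (m≤n+m (suc j) j))
avoiderCount-suc (suc m) j = begin
  (suc m + suc j) C (suc j + suc j)                            ≡⟨ cong (suc (m + suc j) C_) (cong suc (+-suc j j)) ⟩
  suc (m + suc j) C suc (suc (j + j))                          ≡⟨ nCk+nC[k+1]≡[n+1]C[k+1] (m + suc j) (suc (j + j)) ⟨
  (m + suc j) C suc (j + j) + (m + suc j) C suc (suc (j + j))  ≡⟨ +-comm ((m + suc j) C suc (j + j)) _ ⟩
  (m + suc j) C suc (suc (j + j)) + (m + suc j) C suc (j + j)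
    ≡⟨ cong₂ _+_ (cong ((m + suc j) C_) (cong suc (sym (+-suc j j))))
                 (trans (cong (_C suc (j + j)) (+-suc m j)) (sym (hockey-stick j (suc m)))) ⟩
  (m + suc j) C (suc j + suc j) + sumBelow (λ a → avoiderCount (suc a) j) (suc m) ∎
  where open ≡-Reasoning

length-avoiderList : ∀ f lo m j → m ≤ f → length (avoiderList f lo m j) ≡ avoiderCount m j
length-avoiderList _ lo zero zero _ = refl
length-avoiderList _ lo zero (suc j) _ = refl
length-avoiderList (suc f) lo (suc m) zero (s≤s m≤f) =
  trans (length-map _ (avoiderList f (suc lo) m zero))
        (trans (length-avoiderList f (suc lo) m zero m≤f) (avoiderCount-zero m))
  where
  avoiderCount-zero : ∀ m → avoiderCount m zero ≡ avoiderCount (suc m) zero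
  avoiderCount-zero zero = refl
  avoiderCount-zero (suc m) = refl
length-avoiderList (suc f) lo (suc m) (suc j) (s≤s m≤f) = begin
  length (avoiderList (suc f) lo (suc m) (suc j))    ≡⟨ length-++ (map (lo ∷_) (avoiderList f (suc lo) m (suc j))) ⟩
  length (map (lo ∷_) (avoiderList f (suc lo) m (suc j))) + length (withRuns _ lo m m)
    ≡⟨ cong₂ _+_ (trans (length-map _ (avoiderList f (suc lo) m (suc j))) (length-avoiderList f (suc lo) m (suc j) m≤f))
                 (length-withRuns _ lo m m _ λ a<m → length-avoiderList f _ _ j (≤-trans a<m m≤f)) ⟩
  avoiderCount m (suc j) + sumBelow (λ a → avoiderCount (suc a) j) m ≡⟨ avoiderCount-suc m j ⟨
  avoiderCount (suc m) (suc j)                        ∎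
  where open ≡-Reasoning

module _ {A : Set} where

  index-∈-lookup : ∀ (xs : List A) i → Any.index (∈-lookup {xs = xs} i) ≡ i
  index-∈-lookup (x ∷ xs) F.zero = refl
  index-∈-lookup (x ∷ xs) (F.suc i) = cong F.suc (index-∈-lookup xs i)

  lookup-index-∈ : ∀ {xs : List A} {x} (x∈ : x ∈ xs) →
                   _≡_ {A = ∃ λ y → y ∈ xs} (List.lookup xs (Any.index x∈) , ∈-lookup (Any.index x∈)) (x , x∈)
  lookup-index-∈ (here refl) = refl
  lookup-index-∈ {y ∷ xs} (there x∈) = cong (λ (z , z∈) → z , there {x = y} z∈) (lookup-index-∈ x∈)

  ∃∈↔Fin-length : (xs : List A) → (∃ λ x → x ∈ xs) ↔ Fin (length xs)
  ∃∈↔Fin-length xs = mk↔ₛ′ (Any.index ∘ proj₂) (λ i → List.lookup xs i , ∈-lookup i)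
    (index-∈-lookup xs) (lookup-index-∈ ∘ proj₂)

word : ∀ {n m} → Vec (Fin n) m → Word
word σ = map toℕ (Vec.toList σ)

fromWord : ∀ {n} m (w : Word) → length w ≡ m → All (_< n) w → Vec (Fin n) m
fromWord zero [] _ _ = Vec.[]
fromWord (suc m) (x ∷ w) len (x<n ∷ w<n) = F.fromℕ< x<n Vec.∷ fromWord m w (suc-injective len) w<n

word-fromWord : ∀ {n} m w len (w<n : All (_< n) w) → word (fromWord m w len w<n) ≡ w
word-fromWord zero [] _ _ = refl
word-fromWord (suc m) (x ∷ w) len (x<n ∷ w<n) = cong₂ _∷_ (toℕ-fromℕ< x<n) (word-fromWord m w (suc-injective len) w<n)

word-injective : ∀ {n m} (σ σ′ : Vec (Fin n) m) → word σ ≡ word σ′ → σ ≡ σ′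
word-injective Vec.[] Vec.[] _ = refl
word-injective (x Vec.∷ σ) (y Vec.∷ σ′) e =
  cong₂ Vec._∷_ (toℕ-injective (∷-injectiveˡ e)) (word-injective σ σ′ (∷-injectiveʳ e))

length-word : ∀ {n m} (σ : Vec (Fin n) m) → length (word σ) ≡ m
length-word σ = trans (length-map toℕ (Vec.toList σ)) (length-toList σ)

word-bounded : ∀ {n m} (σ : Vec (Fin n) m) → All (_< n) (word σ)
word-bounded σ = All.tabulate λ x∈ → let i , _ , x≡ = ∈-map⁻ toℕ x∈ in subst (_< _) (sym x≡) (toℕ<n i)

Σ-irrelevant-≡ : ∀ {A : Set} {B : A → Set} → (∀ {a} (b b′ : B a) → b ≡ b′) → ∀ {a a′ b b′} → a ≡ a′ →
                 _≡_ {A = Σ A B} (a , b) (a′ , b′)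
Σ-irrelevant-≡ irr {a} {b = b} {b′} refl = cong (a ,_) (irr b b′)

VecWord : ℕ → (Word → Bool) → Word → Set
VecWord n B w = length w ≡ n × All (_< n) w × T (B w)

Σ-vec↔Fin-length : ∀ n (B : Word → Bool) (L : List Word) → Unique L → (∀ w → VecWord n B w ⇔ w ∈ L) →
                   (Σ (Vec (Fin n) n) λ σ → T (B (word σ))) ↔ Fin (length L)
Σ-vec↔Fin-length n B L uq spec = ↔-trans (mk↔ₛ′ to from to∘from from∘to) (∃∈↔Fin-length L)
  where
  to : (Σ (Vec (Fin n) n) λ σ → T (B (word σ))) → ∃ λ w → w ∈ L
  to (σ , t) = word σ , Equivalence.to (spec (word σ)) (length-word σ , word-bounded σ , t)
  from : (∃ λ w → w ∈ L) → Σ (Vec (Fin n) n) λ σ → T (B (word σ))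
  from (w , w∈) with len , bd , t ← Equivalence.from (spec w) w∈ =
    fromWord n w len bd , subst (T ∘ B) (sym (word-fromWord n w len bd)) t
  to∘from : ∀ x → to (from x) ≡ x
  to∘from (w , w∈) with len , bd , t ← Equivalence.from (spec w) w∈ =
    Σ-irrelevant-≡ (unique⇒irrelevant (setoid Word) (Decidable⇒UIP.≡-irrelevant (≡-dec _≟_)) uq)
      (word-fromWord n w len bd)
  from∘to : ∀ x → from (to x) ≡ x
  from∘to (σ , t) with len , bd , _ ← Equivalence.from (spec (word σ)) (proj₂ (to (σ , t))) =
    Σ-irrelevant-≡ T-irrelevant (word-injective _ σ (word-fromWord n (word σ) len bd))

-- Cyclic permutations avoiding [1324] and [1423]

-- AvDes n (p ∷ []) k is by definition Σ (Vec (Fin n) n) λ σ → T (inAvDes p k (word σ)).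
inAvDes : Word → ℕ → Word → Bool
inAvDes p k w = (distinct w ∧ startsWithMin w) ∧ (avoidsAll w (p ∷ []) ∧ (cdes w ≡ᵇ k))

AvDes-empty : ∀ n Π k → n < k → AvDes n Π k ↔ Fin 0
AvDes-empty n Π k n<k = mk↔ₛ′ (⊥-elim ∘ empty) (λ ()) (λ ()) (⊥-elim ∘ empty)
  where
  empty : AvDes n Π k → ⊥
  empty (σ , t)
    with _ , av∧des ← Equivalence.to (T-∧ {isCycRep σ}) t
    with _ , des ← Equivalence.to (T-∧ {avoidsAll (word σ) Π}) av∧des =
    <-irrefl refl (<-≤-trans n<k (begin
      k                 ≡⟨ ≡ᵇ⇒≡ _ k des ⟨
      cdes (word σ)     ≤⟨ cdes≤length (word σ) ⟩
      length (word σ)   ≡⟨ length-word σ ⟩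
      n                 ∎))
    where open ≤-Reasoning

AvDes₀↔ : ∀ p q → AvDes 0 (p ∷ []) 0 ↔ AvDes 0 (q ∷ []) 0
AvDes₀↔ p q = mk↔ₛ′ (λ { (Vec.[] , _) → Vec.[] , _ }) (λ { (Vec.[] , _) → Vec.[] , _ })
                    (λ { (Vec.[] , _) → refl }) (λ { (Vec.[] , _) → refl })

CyclicRep : ℕ → Word → Set
CyclicRep m w = ∃ λ τ → w ≡ 0 ∷ τ × PermOn 1 m τ

cyclicRep⇒ : ∀ m w → length w ≡ suc m → All (_< suc m) w → T (distinct w ∧ startsWithMin w) → CyclicRep m w
cyclicRep⇒ m (x ∷ τ) len (_ ∷ τ<) t with d , s ← Equivalence.to (T-∧ {distinct (x ∷ τ)}) t
  with refl ← ≡ᵇ⇒≡ x 0 s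
  with 0≢τ ∷ uq ← distinct⇒Unique (0 ∷ τ) d
  = τ , refl , perm uq (All.zipWith (λ (0≢y , y<) → n≢0⇒n>0 (0≢y ∘ sym) , y<) (0≢τ , τ<)) (suc-injective len)

cyclicRep⇐ : ∀ m τ → PermOn 1 m τ → VecWord (suc m) (λ w → distinct w ∧ startsWithMin w) (0 ∷ τ)
cyclicRep⇐ m τ (perm uq bd len) =
  cong suc len , z<s ∷ All.map proj₂ bd ,
  Equivalence.from T-∧ (Unique⇒distinct (All.map (λ (0<y , _) → <⇒≢ 0<y) bd ∷ uq) , _)

AvDesRep : ℕ → Word → ℕ → Word → Set
AvDesRep m p k w = ∃ λ τ → w ≡ 0 ∷ τ × PermOn 1 m τ × ¬ Occurs (Cyclic (OrderIso4 p)) (0 ∷ τ) × suc (countDes τ) ≡ k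

inAvDes⇔AvDesRep : ∀ m p k w → 1 ≤ m → length p ≡ 4 → VecWord (suc m) (inAvDes p k) w ⇔ AvDesRep m p k w
inAvDes⇔AvDesRep m p k w 1≤m ∣p∣≡4 = mk⇔ to from
  where
  cdes≡ : ∀ {τ} → PermOn 1 m τ → cdes (0 ∷ τ) ≡ suc (countDes τ)
  cdes≡ {t ∷ τ} p = countDes-∷ʳ-below t τ (PermOn-above p)
  cdes≡ {[]} (perm _ _ refl) = ⊥-elim (<-irrefl refl 1≤m)
  to : VecWord (suc m) (inAvDes p k) w → AvDesRep m p k w
  to (len , w< , t) with rep , av∧des ← Equivalence.to (T-∧ {distinct w ∧ startsWithMin w}) t
    with av , des ← Equivalence.to (T-∧ {avoidsAll w (p ∷ [])}) av∧des
    with τ , refl , pτ ← cyclicRep⇒ m w len w< rep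
    = τ , refl , pτ , Equivalence.to (avoids⇔¬Occurs w p ∣p∣≡4) av , trans (sym (cdes≡ pτ)) (≡ᵇ⇒≡ _ k des)
  from : AvDesRep m p k w → VecWord (suc m) (inAvDes p k) w
  from (τ , refl , pτ , ¬occ , des) with len , w< , rep ← cyclicRep⇐ m τ pτ =
    len , w< , Equivalence.from T-∧ (rep , Equivalence.from T-∧
      (Equivalence.from (avoids⇔¬Occurs (0 ∷ τ) p ∣p∣≡4) ¬occ , ≡⇒≡ᵇ _ k (trans (cdes≡ pτ) des)))

AvoidingRep : (Word → Word) → ℕ → ℕ → Word → Set
AvoidingRep f m k w = ∃ λ τ → w ≡ 0 ∷ τ × PermOn 1 m τ × Avoids213∧4132 (f τ) × suc (countDes (f τ)) ≡ k

AvDesRep⇔AvoidingRep : ∀ {m p k k′ w} (f : Word → Word) →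
  (∀ {τ} → PermOn 1 m τ → (¬ Occurs (Cyclic (OrderIso4 p)) (0 ∷ τ)) ⇔ Avoids213∧4132 (f τ)) →
  (∀ {τ} → PermOn 1 m τ → suc (countDes τ) ≡ k ⇔ suc (countDes (f τ)) ≡ k′) →
  AvDesRep m p k w ⇔ AvoidingRep f m k′ w
AvDesRep⇔AvoidingRep f avoid⇔ des⇔ = mk⇔
  (λ (τ , w≡ , p , ¬occ , des) → τ , w≡ , p , Equivalence.to (avoid⇔ p) ¬occ , Equivalence.to (des⇔ p) des)
  (λ (τ , w≡ , p , good , des) → τ , w≡ , p , Equivalence.from (avoid⇔ p) good , Equivalence.from (des⇔ p) des)

-- The representatives 0 ∷ τ of the classes in Av_(m+1)[1324] with k cyclic descents.
representatives1324 : ℕ → ℕ → List Word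
representatives1324 m zero = []
representatives1324 m (suc j) = map (0 ∷_) (avoiderList m 1 m j)

-- The representatives of the classes in Av_(m+1)[1423], indexed by m + 1 ∸ k for k cyclic descents.
representatives1423 : ℕ → ℕ → List Word
representatives1423 m zero = []
representatives1423 m (suc j) = map ((0 ∷_) ∘ reverse) (avoiderList m 1 m j)

representatives1324-unique : ∀ m k → Unique (representatives1324 m k)
representatives1324-unique m zero = []
representatives1324-unique m (suc j) = Unique.map⁺ ∷-injectiveʳ (avoiderList-unique m 1 m j)

representatives1423-unique : ∀ m k → Unique (representatives1423 m k)
representatives1423-unique m zero = []
representatives1423-unique m (suc j) = Unique.map⁺ (reverse-injective ∘ ∷-injectiveʳ) (avoiderList-unique m 1 m j)

length-representatives1423 : ∀ m k → length (representatives1423 m k) ≡ length (representatives1324 m k)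
length-representatives1423 m zero = refl
length-representatives1423 m (suc j) =
  trans (length-map _ (avoiderList m 1 m j)) (sym (length-map _ (avoiderList m 1 m j)))

∈-representatives1324⇔ : ∀ m k w → w ∈ representatives1324 m k ⇔ AvoidingRep id m k w
∈-representatives1324⇔ m k w = mk⇔ (to k) from
  where
  to : ∀ k → w ∈ representatives1324 m k → AvoidingRep id m k w
  to (suc j) w∈ with τ , τ∈ , refl ← ∈-map⁻ _ w∈ with p , good , des ← avoiderList-sound m 1 m j τ∈ =
    τ , refl , p , good , cong suc des
  from : AvoidingRep id m k w → w ∈ representatives1324 m k
  from (τ , refl , p , good , refl) = ∈-map⁺ _ (avoiderList-complete m 1 m _ ≤-refl (p , good , refl))

∈-representatives1423⇔ : ∀ m k w → w ∈ representatives1423 m k ⇔ AvoidingRep reverse m k w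
∈-representatives1423⇔ m k w = mk⇔ (to k) from
  where
  to : ∀ k → w ∈ representatives1423 m k → AvoidingRep reverse m k w
  to (suc j) w∈ with ρ , ρ∈ , refl ← ∈-map⁻ _ w∈ with p , good , des ← avoiderList-sound m 1 m j ρ∈ =
    reverse ρ , refl , PermOn-reverse p ,
    subst Avoids213∧4132 (sym (reverse-involutive ρ)) good , cong suc (trans (cong countDes (reverse-involutive ρ)) des)
  from : AvoidingRep reverse m k w → w ∈ representatives1423 m k
  from (τ , refl , p , good , refl) =
    subst (λ τ′ → 0 ∷ τ′ ∈ representatives1423 m (suc (countDes (reverse τ)))) (reverse-involutive τ)
      (∈-map⁺ ((0 ∷_) ∘ reverse) (avoiderList-complete m 1 m _ ≤-refl (PermOn-reverse p , good , refl)))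

inAvDes1324⇔ : ∀ m k w → 1 ≤ m → VecWord (suc m) (inAvDes p1324 k) w ⇔ w ∈ representatives1324 m k
inAvDes1324⇔ m k w 1≤m = ⇔.trans (inAvDes⇔AvDesRep m p1324 k w 1≤m refl)
  (⇔.trans (AvDesRep⇔AvoidingRep {p = p1324} {k = k} {k′ = k} {w = w} id avoid⇔ (λ _ → ⇔.refl))
           (⇔.sym (∈-representatives1324⇔ m k w)))
  where
  avoid⇔ : ∀ {τ} → PermOn 1 m τ → (¬ Occurs (Cyclic (OrderIso4 p1324)) (0 ∷ τ)) ⇔ Avoids213∧4132 τ
  avoid⇔ p = ⇔.trans (¬Occurs⇔ orderIso⇔Is1324) (¬Cyclic1324⇔Avoids213∧4132 (PermOn-above p))

descents-complement : ∀ {D E m k} → E + D ≡ m → k ≤ suc (suc m) → suc D ≡ k ⇔ suc E ≡ suc (suc m) ∸ k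
descents-complement {D} {E} {k = k} refl k≤ = mk⇔
  (λ { refl → sym (m+n∸n≡m (suc E) D) })
  (λ e → begin
    suc D                           ≡⟨ m+n∸n≡m (suc D) E ⟨
    suc D + E ∸ E                   ≡⟨ cong (λ x → suc x ∸ E) (+-comm D E) ⟩
    suc (suc (E + D)) ∸ suc E       ≡⟨ cong (suc (suc (E + D)) ∸_) e ⟩
    suc (suc (E + D)) ∸ (suc (suc (E + D)) ∸ k) ≡⟨ m∸[m∸n]≡n k≤ ⟩
    k                               ∎)
  where open ≡-Reasoning

inAvDes1423⇔ : ∀ m k w → k ≤ suc (suc m) →
               VecWord (suc (suc m)) (inAvDes p1423 k) w ⇔ w ∈ representatives1423 (suc m) (suc (suc m) ∸ k)
inAvDes1423⇔ m k w k≤ = ⇔.trans (inAvDes⇔AvDesRep (suc m) p1423 k w (s≤s z≤n) refl)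
  (⇔.trans (AvDesRep⇔AvoidingRep {p = p1423} {w = w} reverse avoid⇔ complement)
           (⇔.sym (∈-representatives1423⇔ (suc m) _ w)))
  where
  avoid⇔ : ∀ {τ} → PermOn 1 (suc m) τ → (¬ Occurs (Cyclic (OrderIso4 p1423)) (0 ∷ τ)) ⇔ Avoids213∧4132 (reverse τ)
  avoid⇔ p = ⇔.trans (¬Occurs⇔ orderIso⇔Is1423) (¬Cyclic1423⇔Avoids213∧4132-reverse (PermOn-above p))
  complement : ∀ {τ} → PermOn 1 (suc m) τ → suc (countDes τ) ≡ k ⇔ suc (countDes (reverse τ)) ≡ suc (suc m) ∸ k
  complement {x ∷ τ} (perm uq _ len) = descents-complement (trans (countDes-reverse x τ uq) (suc-injective len)) k≤

avoiderCount≡formulaCoef : ∀ m j → avoiderCount (suc m) j ≡ formulaCoef (suc (suc m)) (suc j)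
avoiderCount≡formulaCoef m j with j ≤? m
... | yes j≤m = begin
  (m + j) C (j + j)                   ≡⟨ nCk≡nC[n∸k] (+-monoˡ-≤ j j≤m) ⟩
  (m + j) C ((m + j) ∸ (j + j))       ≡⟨ cong₂ _C_ (cong (_∸ 1) (+-suc m j)) ∸-eq ⟨
  (m + suc j ∸ 1) C (suc m ∸ j ∸ 1)   ≡⟨ cong (λ b → if b then coefficient else 0) (<ᵇ-true (s≤s j≤m)) ⟨
  formulaCoef (suc (suc m)) (suc j)   ∎
  where
  open ≡-Reasoning
  coefficient = (m + suc j ∸ 1) C (suc m ∸ j ∸ 1)
  ∸-eq : suc m ∸ j ∸ 1 ≡ (m + j) ∸ (j + j)
  ∸-eq = begin
    suc m ∸ j ∸ 1     ≡⟨ cong (_∸ 1) (+-∸-assoc 1 j≤m) ⟩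
    m ∸ j             ≡⟨ cong (_∸ j) (m+n∸n≡m m j) ⟨
    (m + j) ∸ j ∸ j   ≡⟨ ∸-+-assoc (m + j) j j ⟩
    (m + j) ∸ (j + j) ∎
... | no j≰m = begin
  (m + j) C (j + j)                   ≡⟨ k>n⇒nCk≡0 (+-monoˡ-< j (≰⇒> j≰m)) ⟩
  0                                   ≡⟨ cong (λ b → if b then coefficient else 0) (<ᵇ-false (≰⇒> j≰m)) ⟨
  formulaCoef (suc (suc m)) (suc j)   ∎
  where
  open ≡-Reasoning
  coefficient = (m + suc j ∸ 1) C (suc m ∸ j ∸ 1)

length-representatives1324 : ∀ m k → length (representatives1324 (suc m) k) ≡ formulaCoef (suc (suc m)) k
length-representatives1324 m zero = refl
length-representatives1324 m (suc j) = trans (length-map _ (avoiderList (suc m) 1 (suc m) j))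
  (trans (length-avoiderList (suc m) 1 (suc m) j ≤-refl) (avoiderCount≡formulaCoef m j))

AvDes1324↔ : ∀ m k → AvDes (suc (suc m)) (p1324 ∷ []) k ↔ Fin (length (representatives1324 (suc m) k))
AvDes1324↔ m k = Σ-vec↔Fin-length _ (inAvDes p1324 k) (representatives1324 (suc m) k)
  (representatives1324-unique (suc m) k) (λ w → inAvDes1324⇔ (suc m) k w (s≤s z≤n))

AvDes1423↔ : ∀ m k → k ≤ suc (suc m) →
             AvDes (suc (suc m)) (p1423 ∷ []) k ↔ Fin (length (representatives1324 (suc m) (suc (suc m) ∸ k)))
AvDes1423↔ m k k≤ = subst (λ c → AvDes (suc (suc m)) (p1423 ∷ []) k ↔ Fin c) (length-representatives1423 (suc m) k′)
  (Σ-vec↔Fin-length _ (inAvDes p1423 k) (representatives1423 (suc m) k′)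
    (representatives1423-unique (suc m) k′) (λ w → inAvDes1423⇔ m k w k≤))
  where k′ = suc (suc m) ∸ k

mainTheorem15 :
    ((n : ℕ) → n ≢ 1 →
      ((k : ℕ) → k ≤ n → AvDes n (p1423 ∷ []) k ↔ AvDes n (p1324 ∷ []) (n ∸ k))
      × ((k : ℕ) → n < k → (AvDes n (p1423 ∷ []) k ↔ Fin 0) × (AvDes n (p1324 ∷ []) k ↔ Fin 0)))
    × ((n : ℕ) → 2 ≤ n → (k : ℕ) → AvDes n (p1324 ∷ []) k ↔ Fin (formulaCoef n k))
mainTheorem15 = (λ n n≢1 → symmetry n n≢1 , beyond n) , coefficients
  where
  symmetry : ∀ n → n ≢ 1 → ∀ k → k ≤ n → AvDes n (p1423 ∷ []) k ↔ AvDes n (p1324 ∷ []) (n ∸ k)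
  symmetry zero _ zero _ = AvDes₀↔ p1423 p1324
  symmetry (suc zero) n≢1 = ⊥-elim (n≢1 refl)
  symmetry (suc (suc m)) _ k k≤n = ↔-trans (AvDes1423↔ m k k≤n) (↔-sym (AvDes1324↔ m (suc (suc m) ∸ k)))
  beyond : ∀ n k → n < k → (AvDes n (p1423 ∷ []) k ↔ Fin 0) × (AvDes n (p1324 ∷ []) k ↔ Fin 0)
  beyond n k n<k = AvDes-empty n (p1423 ∷ []) k n<k , AvDes-empty n (p1324 ∷ []) k n<k
  coefficients : ∀ n → 2 ≤ n → ∀ k → AvDes n (p1324 ∷ []) k ↔ Fin (formulaCoef n k)
  coefficients (suc zero) (s≤s ())
  coefficients (suc (suc m)) _ k =
    subst (λ c → AvDes (suc (suc m)) (p1324 ∷ []) k ↔ Fin c) (length-representatives1324 m k) (AvDes1324↔ m k)
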